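{- There are infinitely many sequences $(X_n)_{n\ge1}$ of loopless digraphs such that $U_{X_1},U_{X_2},\dots$ form an algebraic basis of $Sym$ over $\mathbb{Q}$, i.e., they are algebraically independent and generate $Sym$ as a $\mathbb{Q}$-algebra.
   Context: A digraph $X=(V,E)$ has a finite vertex set $V$, $|V|=n$, and $E\subseteq V\times V$; it is loopless if it has no edges $(v,v)$. A $V$-listing is a bijection $\pi:[n]\to V$, and $X\mathrm{Des}(\pi)=\{i\in[n-1]:(\pi_i,\pi_{i+1})\in E\}$. Let $F_I=\sum_{i_1\le\dots\le i_n,\ i_j<i_{j+1}\ (j\in I)}x_{i_1}\cdots x_{i_n}$ for $I\subseteq[n-1]$. The Redei-Berge function is $U_X=\sum_\pi F_{X\mathrm{Des}(\pi)}$ over all $V$-listings; it lies in the algebra $Sym$ of symmetric functions over $\mathbb{Q}$. -}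

module Defs where

open import Data.Bool using (Bool; true; false; if_then_else_; _∧_)
open import Data.Nat as ℕ using (ℕ; zero; suc; _<ᵇ_; _≡ᵇ_)
open import Data.Fin using (Fin)
open import Data.Fin.Properties as FinP using ()
open import Data.List using (List; []; _∷_; [_]; map; concatMap; filter; upTo; replicate; _++_; length; zipWith; foldr)
open import Data.List.Relation.Unary.Any using (Any)
open import Data.List.Relation.Unary.All using (All)
open import Data.List.Relation.Unary.Unique.Propositional using (Unique)
open import Data.List.Relation.Binary.Permutation.Propositional using (_↭_)
open import Data.Product using (Σ; ∃; _×_; _,_; proj₁; proj₂)
open import Data.Rational as ℚ using (ℚ; 0ℚ; 1ℚ)
open import Relation.Binary.PropositionalEquality using (_≡_; _≢_)
open import Relation.Nullary using (¬_)

-- Digraphs on the vertex set Fin n (the vertex set only matters up to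
-- relabelling, and U_X is invariant under relabelling).

record Digraph : Set where
  field
    size : ℕ
    edge : Fin size → Fin size → Bool
open Digraph public

Loopless : Digraph → Set
Loopless X = ∀ v → edge X v v ≡ false

Iso : Digraph → Digraph → Set
Iso X Y = Σ (Fin (size X) → Fin (size Y)) λ f → Σ (Fin (size Y) → Fin (size X)) λ g →
  (∀ u → g (f u) ≡ u) × (∀ w → f (g w) ≡ w) × (∀ u v → edge Y (f u) (f v) ≡ edge X u v)

-- Formal power series over ℚ in the variables x₀, x₁, x₂, …
-- A monomial x₀^e₀ x₁^e₁ ⋯ x_r^e_r is an exponent list (e₀ ∷ … ∷ e_r ∷ []);
-- lists differing by trailing zeros denote the same monomial.

Mon : Set
Mon = List ℕ

Ser : Set
Ser = Mon → ℚ

_≈_ : Ser → Ser → Set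
f ≈ g = ∀ e → f e ≡ g e

infix 4 _≈_

zeroS : Ser
zeroS _ = 0ℚ

allZero : Mon → Bool
allZero [] = true
allZero (k ∷ e) = (k ≡ᵇ 0) ∧ allZero e

oneS : Ser
oneS e = if allZero e then 1ℚ else 0ℚ

_+S_ : Ser → Ser → Ser
(f +S g) e = f e ℚ.+ g e

scale : ℚ → Ser → Ser
scale c f e = c ℚ.* f e

sumS : List Ser → Ser
sumS = foldr _+S_ zeroS

sumℚ : List ℚ → ℚ
sumℚ = foldr ℚ._+_ 0ℚ

subs : Mon → List Mon
subs [] = [ [] ]
subs (k ∷ e) = concatMap (λ i → map (i ∷_) (subs e)) (upTo (suc k))

_*S_ : Ser → Ser → Ser
(f *S g) e = sumℚ (map (λ d → f d ℚ.* g (zipWith ℕ._∸_ e d)) (subs e))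

powS : Ser → ℕ → Ser
powS f zero = oneS
powS f (suc k) = f *S powS f k

degree : Mon → ℕ
degree = foldr ℕ._+_ 0

-- well-defined on monomials (independent of trailing zeros)
PadInv : Ser → Set
PadInv f = ∀ e → f (e ++ [ 0 ]) ≡ f e

PermInv : Ser → Set
PermInv f = ∀ e e′ → e ↭ e′ → f e ≡ f e′

BoundedDeg : Ser → Set
BoundedDeg f = ∃ λ d → ∀ e → d ℕ.< degree e → f e ≡ 0ℚ

IsSym : Ser → Set
IsSym f = PadInv f × PermInv f × BoundedDeg f

-- Fundamental quasisymmetric functions F_I, I ⊆ [n-1] given by its
-- characteristic list (b₁, …, b_{n-1}) : bᵢ ≡ true iff i ∈ I.

-- the monomial x^e written as x_{i₁} ⋯ x_{i_n} with i₁ ≤ ⋯ ≤ i_n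
idxFrom : ℕ → Mon → List ℕ
idxFrom i [] = []
idxFrom i (k ∷ e) = replicate k i ++ idxFrom (suc i) e

idx : Mon → List ℕ
idx = idxFrom 0

strictAt : List Bool → List ℕ → Bool
strictAt (b ∷ I) (i ∷ j ∷ is) = (if b then i <ᵇ j else true) ∧ strictAt I (j ∷ is)
strictAt _ _ = true

F : ℕ → List Bool → Ser
F n I e = if (length (idx e) ≡ᵇ n) ∧ strictAt I (idx e) then 1ℚ else 0ℚ

allLists : {A : Set} → ℕ → List A → List (List A)
allLists zero xs = [ [] ]
allLists (suc n) xs = concatMap (λ x → map (x ∷_) (allLists n xs)) xs

-- V-listings: bijections [n] → Fin n, i.e. duplicate-free lists of length n
listings : (n : ℕ) → List (List (Fin n))
listings n = filter (Data.List.Relation.Unary.Unique.DecPropositional.unique? FinP._≟_)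
                    (allLists n (Data.List.allFin n))
  where import Data.List.Relation.Unary.Unique.DecPropositional

xdes : (X : Digraph) → List (Fin (size X)) → List Bool
xdes X (u ∷ v ∷ π) = edge X u v ∷ xdes X (v ∷ π)
xdes X _ = []

U : Digraph → Ser
U X = sumS (map (λ π → F (size X) (xdes X π)) (listings (size X)))

-- Algebraic bases of Sym.
-- A polynomial in y₀, y₁, … over ℚ is a finite list of terms (c , a),
-- c the coefficient, a the exponent list of the monomial ∏ yᵢ^{aᵢ}.

monoFrom : (ℕ → Ser) → ℕ → List ℕ → Ser
monoFrom b i [] = oneS
monoFrom b i (k ∷ a) = powS (b i) k *S monoFrom b (suc i) a

mono : (ℕ → Ser) → List ℕ → Ser
mono b = monoFrom b 0

evalPoly : (ℕ → Ser) → List (ℚ × List ℕ) → Ser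
evalPoly b ts = sumS (map (λ t → scale (proj₁ t) (mono b (proj₂ t))) ts)

data Canon : List ℕ → Set where
  canon[] : Canon []
  canon1  : ∀ k → k ≢ 0 → Canon [ k ]
  canon∷  : ∀ k a → a ≢ [] → Canon a → Canon (k ∷ a)

-- algebraically independent: the distinct monomials in the b_i are
-- linearly independent over ℚ.
AlgIndep : (ℕ → Ser) → Set
AlgIndep b = ∀ (ts : List (ℚ × List ℕ)) →
  All Canon (map proj₂ ts) → Unique (map proj₂ ts) →
  Any (λ t → proj₁ t ≢ 0ℚ) ts → ¬ (evalPoly b ts ≈ zeroS)

Generates : (ℕ → Ser) → Set
Generates b = ∀ f → IsSym f → ∃ λ ts → evalPoly b ts ≈ f

AlgBasis : (ℕ → Ser) → Set
AlgBasis b = AlgIndep b × Generates b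

-- In the complete digraph K_m every position of every listing is a descent, so U(K_m) = m! e_m.
-- It therefore suffices that for every bijection τ of ℕ moving points by a bounded amount the
-- series e_{τ(n)+1} form an algebraic basis; the transpositions τ = (0 k) then give, for different
-- k, sequences that already differ in their first digraph K_{k+1}.
--
-- The basis property is the fundamental theorem of symmetric functions. In the lexicographic order
-- on exponents, ∏ e_{τ(n)+1}^{a_n} has as leading monomial the partition whose conjugate has a_n
-- parts equal to τ(n)+1, with positive coefficient, and a ↦ this partition is a bijection onto all
-- partitions. Independence follows by looking at the largest leading monomial of a relation;
-- generation by repeatedly cancelling the lexicographically largest monomial of a symmetric series.

module Submission where

open import Data.Bool using (Bool; true; false; if_then_else_; _∧_; not)
open import Data.Bool.ListAction using (all)
open import Data.Bool.Properties as Boolₚ using (T-≡)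
open import Data.Empty using (⊥-elim)
open import Data.Fin using (Fin)
import Data.Fin.Properties as Finₚ
open import Data.List using (List; []; _∷_; [_]; foldr; map; concatMap; upTo; applyUpTo; _++_; length; zipWith; replicate; allFin)
import Data.List.Properties as Listₚ
open import Data.List.Membership.Propositional using (_∈_; lose)
import Data.List.Membership.Propositional.Properties as ∈ₚ
open import Data.List.Relation.Unary.All as All using (All; []; _∷_)
import Data.List.Relation.Unary.All.Properties as Allₚ
open import Data.List.Relation.Unary.AllPairs using ([]; _∷_)
open import Data.List.Relation.Unary.Any as Any using (Any; here; there)
open import Data.List.Relation.Unary.Linked as Linked using (Linked; []; [-]; _∷_)
open import Data.List.Relation.Unary.Unique.Propositional using (Unique)
import Data.List.Relation.Unary.Unique.Propositional.Properties as Uniqueₚ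
import Data.List.Relation.Unary.Unique.DecPropositional as UniqueDec
open import Data.List.Relation.Binary.Permutation.Propositional as ↭ using (_↭_)
import Data.List.Sort
import Relation.Binary.Construct.Flip.EqAndOrd as Flip
open import Data.Nat as ℕ using (ℕ; zero; suc; _+_; _*_; _∸_; _^_; _≤_; _<_; z≤n; s≤s; _<ᵇ_; _≡ᵇ_; _≤ᵇ_)
import Data.Nat.Properties as ℕₚ
import Data.Nat.ListAction.Properties as ListAction
open import Data.Product using (Σ; ∃; _×_; _,_; proj₁; proj₂)
open import Data.Rational as ℚ using (ℚ; 0ℚ; 1ℚ; Positive)
import Data.Rational.Properties as ℚₚ
open import Data.Sum using (_⊎_; inj₁; inj₂)
open import Function using (_∘_; Equivalence)
open import Relation.Binary.Definitions using (tri<; tri≈; tri>)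
open import Relation.Binary.PropositionalEquality hiding ([_])
open import Relation.Nullary using (¬_; ¬?; Dec; yes; no; does)
open import Relation.Nullary.Decidable using (_×-dec_)

open import Defs

∑ : {A : Set} → (A → ℚ) → List A → ℚ
∑ f xs = sumℚ (map f xs)

∑< : ℕ → (ℕ → ℚ) → ℚ
∑< n f = sumℚ (applyUpTo f n)

sumℚ-++ : (xs ys : List ℚ) → sumℚ (xs ++ ys) ≡ sumℚ xs ℚ.+ sumℚ ys
sumℚ-++ []       ys = sym (ℚₚ.+-identityˡ _)
sumℚ-++ (x ∷ xs) ys = trans (cong (x ℚ.+_) (sumℚ-++ xs ys)) (sym (ℚₚ.+-assoc x _ _))

count : {A : Set} → List A → ℚ
count = ∑ (λ _ → 1ℚ)

module _ {A : Set} where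

  ∑-concatMap : {B : Set} (f : B → ℚ) (g : A → List B) (xs : List A) →
                ∑ f (concatMap g xs) ≡ ∑ (λ x → ∑ f (g x)) xs
  ∑-concatMap f g []       = refl
  ∑-concatMap f g (x ∷ xs) = begin
    sumℚ (map f (g x ++ concatMap g xs))   ≡⟨ cong sumℚ (Listₚ.map-++ f (g x) _) ⟩
    sumℚ (map f (g x) ++ map f (concatMap g xs))
                                            ≡⟨ sumℚ-++ (map f (g x)) _ ⟩
    ∑ f (g x) ℚ.+ ∑ f (concatMap g xs)     ≡⟨ cong (∑ f (g x) ℚ.+_) (∑-concatMap f g xs) ⟩
    ∑ f (g x) ℚ.+ ∑ (λ x → ∑ f (g x)) xs   ∎
    where open ≡-Reasoning

  ∑-cong : {f g : A → ℚ} → (∀ x → f x ≡ g x) → ∀ xs → ∑ f xs ≡ ∑ g xs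
  ∑-cong f≗g xs = cong sumℚ (Listₚ.map-cong f≗g xs)

  ∑-congᴬ : {f g : A → ℚ} {xs : List A} → All (λ x → f x ≡ g x) xs → ∑ f xs ≡ ∑ g xs
  ∑-congᴬ []         = refl
  ∑-congᴬ (eq ∷ eqs) = cong₂ ℚ._+_ eq (∑-congᴬ eqs)

  ∑-zeroᴬ : {f : A → ℚ} {xs : List A} → All (λ x → f x ≡ 0ℚ) xs → ∑ f xs ≡ 0ℚ
  ∑-zeroᴬ []        = refl
  ∑-zeroᴬ (z ∷ zs) rewrite z | ∑-zeroᴬ zs = refl

  ∑-zero : {f : A → ℚ} → (∀ x → f x ≡ 0ℚ) → ∀ xs → ∑ f xs ≡ 0ℚ
  ∑-zero f≡0 xs = ∑-zeroᴬ {xs = xs} (All.tabulate (λ {x} _ → f≡0 x))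

  ∑-const : (c : ℚ) (xs : List A) → ∑ (λ _ → c) xs ≡ count xs ℚ.* c
  ∑-const c []       = sym (ℚₚ.*-zeroˡ c)
  ∑-const c (x ∷ xs) = begin
    c ℚ.+ ∑ (λ _ → c) xs                        ≡⟨ cong₂ ℚ._+_ (sym (ℚₚ.*-identityˡ c)) (∑-const c xs) ⟩
    1ℚ ℚ.* c ℚ.+ count xs ℚ.* c                 ≡⟨ sym (ℚₚ.*-distribʳ-+ c 1ℚ (count xs)) ⟩
    (1ℚ ℚ.+ count xs) ℚ.* c                     ∎
    where open ≡-Reasoning

  sumS-map : (h : A → Ser) (xs : List A) (e : Mon) → sumS (map h xs) e ≡ ∑ (λ x → h x e) xs
  sumS-map h []       e = refl
  sumS-map h (x ∷ xs) e = cong (h x e ℚ.+_) (sumS-map h xs e)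

∑-upTo : ∀ n (f : ℕ → ℚ) → ∑ f (upTo n) ≡ ∑< n f
∑-upTo n f = cong sumℚ (Listₚ.map-applyUpTo (λ i → i) f n)

∑<-cong : ∀ n {f g : ℕ → ℚ} → (∀ i → i < n → f i ≡ g i) → ∑< n f ≡ ∑< n g
∑<-cong zero    f≡g = refl
∑<-cong (suc n) f≡g = cong₂ ℚ._+_ (f≡g 0 (s≤s z≤n)) (∑<-cong n (λ i i<n → f≡g (suc i) (s≤s i<n)))

∑<-zero : ∀ n {f : ℕ → ℚ} → (∀ i → i < n → f i ≡ 0ℚ) → ∑< n f ≡ 0ℚ
∑<-zero zero    f≡0 = refl
∑<-zero (suc n) f≡0 rewrite f≡0 0 (s≤s z≤n) =
  trans (ℚₚ.+-identityˡ _) (∑<-zero n (λ i i<n → f≡0 (suc i) (s≤s i<n)))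

∑<-single : ∀ n {f : ℕ → ℚ} a → a < n → (∀ i → i ≢ a → f i ≡ 0ℚ) → ∑< n f ≡ f a
∑<-single (suc n) {f} zero _ f≡0 =
  trans (cong (f 0 ℚ.+_) (∑<-zero n (λ i _ → f≡0 (suc i) (λ ())))) (ℚₚ.+-identityʳ _)
∑<-single (suc n) (suc a) (s≤s a<n) f≡0 rewrite f≡0 0 (λ ()) =
  trans (ℚₚ.+-identityˡ _) (∑<-single n a a<n (λ i i≢a → f≡0 (suc i) (i≢a ∘ ℕₚ.suc-injective)))

∑<-+ : ∀ n (f g : ℕ → ℚ) → ∑< n (λ i → f i ℚ.+ g i) ≡ ∑< n f ℚ.+ ∑< n g
∑<-+ zero    f g = refl
∑<-+ (suc n) f g rewrite ∑<-+ n (f ∘ suc) (g ∘ suc) = +-interchange (f 0) (g 0) _ _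
  where
  open import Data.Rational.Solver
  open +-*-Solver
  +-interchange : ∀ a b c d → (a ℚ.+ b) ℚ.+ (c ℚ.+ d) ≡ (a ℚ.+ c) ℚ.+ (b ℚ.+ d)
  +-interchange = solve 4 (λ a b c d → (a :+ b) :+ (c :+ d) := (a :+ c) :+ (b :+ d)) refl

∑<-comm : ∀ m n (f : ℕ → ℕ → ℚ) → ∑< m (λ i → ∑< n (f i)) ≡ ∑< n (λ j → ∑< m (λ i → f i j))
∑<-comm zero    n f = sym (∑<-zero n (λ _ _ → refl))
∑<-comm (suc m) n f rewrite ∑<-comm m n (f ∘ suc) = sym (∑<-+ n (f 0) _)

∑-single-key : {A B : Set} (key : A → B) (f : A → ℚ) {xs : List A} {x : A} → Unique (map key xs) → x ∈ xs →
               (∀ y → y ∈ xs → key y ≢ key x → f y ≡ 0ℚ) → ∑ f xs ≡ f x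
∑-single-key key f {y ∷ xs} (y∉ ∷ uniq) (here refl) others≡0 =
  trans (cong (f y ℚ.+_) (∑-zeroᴬ {xs = xs} (All.tabulate λ {z} z∈xs →
           others≡0 z (there z∈xs) (All.lookup (Allₚ.map⁻ y∉) z∈xs ∘ sym))))
        (ℚₚ.+-identityʳ (f y))
∑-single-key key f {y ∷ xs} (y∉ ∷ uniq) (there x∈xs) others≡0 =
  trans (cong (ℚ._+ ∑ f xs) (others≡0 y (here refl) (All.lookup (Allₚ.map⁻ y∉) x∈xs)))
        (trans (ℚₚ.+-identityˡ _) (∑-single-key key f uniq x∈xs (λ z z∈xs → others≡0 z (there z∈xs))))

pos⇒≢0 : ∀ x .{{_ : Positive x}} → x ≢ 0ℚ
pos⇒≢0 x x≡0 = ℚₚ.<-irrefl refl (subst (0ℚ ℚ.<_) x≡0 (ℚₚ.positive⁻¹ x))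

x*y≡0⇒x≡0 : ∀ x y .{{_ : Positive y}} → x ℚ.* y ≡ 0ℚ → x ≡ 0ℚ
x*y≡0⇒x≡0 x y xy≡0 = begin
  x                        ≡⟨ ℚₚ.*-identityʳ x ⟨
  x ℚ.* 1ℚ                 ≡⟨ cong (x ℚ.*_) (ℚₚ.*-inverseʳ y) ⟨
  x ℚ.* (y ℚ.* ℚ.1/ y)     ≡⟨ ℚₚ.*-assoc x y (ℚ.1/ y) ⟨
  (x ℚ.* y) ℚ.* ℚ.1/ y     ≡⟨ cong (ℚ._* ℚ.1/ y) xy≡0 ⟩
  0ℚ ℚ.* ℚ.1/ y            ≡⟨ ℚₚ.*-zeroˡ (ℚ.1/ y) ⟩
  0ℚ                       ∎
  where
  open ≡-Reasoning
  instance _ = ℚₚ.pos⇒nonZero y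

c*m+[x-c*m]≡x : ∀ c m x → c ℚ.* m ℚ.+ (x ℚ.+ (ℚ.- c) ℚ.* m) ≡ x
c*m+[x-c*m]≡x = solve 3 (λ c m x → c :* m :+ (x :+ (:- c) :* m) := x) refl
  where
  open import Data.Rational.Solver using (module +-*-Solver)
  open +-*-Solver

x-[x/k]*k≡0 : ∀ x k .{{_ : ℚ.NonZero k}} → x ℚ.+ (ℚ.- (x ℚ.* ℚ.1/ k)) ℚ.* k ≡ 0ℚ
x-[x/k]*k≡0 x k = begin
  x ℚ.+ (ℚ.- (x ℚ.* ℚ.1/ k)) ℚ.* k   ≡⟨ cong (x ℚ.+_) (ℚₚ.neg-distribˡ-* (x ℚ.* ℚ.1/ k) k) ⟨
  x ℚ.+ ℚ.- (x ℚ.* ℚ.1/ k ℚ.* k)     ≡⟨ cong (λ y → x ℚ.+ ℚ.- y) (ℚₚ.*-assoc x (ℚ.1/ k) k) ⟩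
  x ℚ.+ ℚ.- (x ℚ.* (ℚ.1/ k ℚ.* k))   ≡⟨ cong (λ y → x ℚ.+ ℚ.- (x ℚ.* y)) (ℚₚ.*-inverseˡ k) ⟩
  x ℚ.+ ℚ.- (x ℚ.* 1ℚ)               ≡⟨ cong (λ y → x ℚ.+ ℚ.- y) (ℚₚ.*-identityʳ x) ⟩
  x ℚ.+ ℚ.- x                        ≡⟨ ℚₚ.+-inverseʳ x ⟩
  0ℚ                                 ∎
  where open ≡-Reasoning

count-nonNeg : {A : Set} (xs : List A) → ℚ.NonNegative (count xs)
count-nonNeg []       = _
count-nonNeg (x ∷ xs) = ℚₚ.pos⇒nonNeg (count (x ∷ xs)) {{ℚₚ.pos+nonNeg⇒pos 1ℚ (count xs) {{count-nonNeg xs}}}}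

count-pos : {A : Set} {x : A} {xs : List A} → x ∈ xs → Positive (count xs)
count-pos {xs = y ∷ ys} _ = ℚₚ.pos+nonNeg⇒pos 1ℚ (count ys) {{count-nonNeg ys}}

-- `slice f i` is the coefficient of x₀^i in f, a series in the remaining variables.
slice : Ser → ℕ → Ser
slice f i e = f (i ∷ e)

*S-[] : ∀ f g → (f *S g) [] ≡ f [] ℚ.* g []
*S-[] f g = ℚₚ.+-identityʳ _

*S-∷ : ∀ f g k e → (f *S g) (k ∷ e) ≡ ∑< (suc k) (λ i → (slice f i *S slice g (k ∸ i)) e)
*S-∷ f g k e = begin
  ∑ term (concatMap (λ i → map (i ∷_) (subs e)) (upTo (suc k)))
    ≡⟨ ∑-concatMap term (λ i → map (i ∷_) (subs e)) (upTo (suc k)) ⟩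
  ∑ (λ i → ∑ term (map (i ∷_) (subs e))) (upTo (suc k))
    ≡⟨ ∑-cong (λ i → cong sumℚ (sym (Listₚ.map-∘ (subs e)))) (upTo (suc k)) ⟩
  ∑ (λ i → (slice f i *S slice g (k ∸ i)) e) (upTo (suc k))
    ≡⟨ ∑-upTo (suc k) (λ i → (slice f i *S slice g (k ∸ i)) e) ⟩
  ∑< (suc k) (λ i → (slice f i *S slice g (k ∸ i)) e) ∎
  where
  open ≡-Reasoning
  term : Mon → ℚ
  term d = f d ℚ.* g (zipWith _∸_ (k ∷ e) d)

*S-cong : ∀ {f f′ g g′} → f ≈ f′ → g ≈ g′ → f *S g ≈ f′ *S g′
*S-cong f≈f′ g≈g′ e = ∑-cong (λ d → cong₂ ℚ._*_ (f≈f′ d) (g≈g′ _)) (subs e)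

*S-zeroˡ : ∀ f g → (∀ d → f d ≡ 0ℚ) → ∀ e → (f *S g) e ≡ 0ℚ
*S-zeroˡ f g f≡0 e =
  ∑-zero (λ d → trans (cong (ℚ._* g (zipWith _∸_ e d)) (f≡0 d)) (ℚₚ.*-zeroˡ (g (zipWith _∸_ e d)))) (subs e)

*S-zeroʳ : ∀ f g → (∀ d → g d ≡ 0ℚ) → ∀ e → (f *S g) e ≡ 0ℚ
*S-zeroʳ f g g≡0 e = ∑-zero (λ d → trans (cong (f d ℚ.*_) (g≡0 _)) (ℚₚ.*-zeroʳ (f d))) (subs e)

PadInv-slice : ∀ f i → PadInv f → PadInv (slice f i)
PadInv-slice f i pad e = pad (i ∷ e)

PadInv-*S : ∀ f g → PadInv f → PadInv g → PadInv (f *S g)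
PadInv-*S f g padf padg [] = begin
  (f *S g) [ 0 ]                                 ≡⟨ trans (*S-∷ f g 0 []) (ℚₚ.+-identityʳ _) ⟩
  (slice f 0 *S slice g 0) []                    ≡⟨ *S-[] (slice f 0) (slice g 0) ⟩
  f [ 0 ] ℚ.* g [ 0 ]                            ≡⟨ cong₂ ℚ._*_ (padf []) (padg []) ⟩
  f [] ℚ.* g []                                  ≡⟨ sym (*S-[] f g) ⟩
  (f *S g) []                                    ∎
  where open ≡-Reasoning
PadInv-*S f g padf padg (k ∷ e) =
  trans (*S-∷ f g k (e ++ [ 0 ]))
        (trans (∑<-cong (suc k) (λ i _ → PadInv-*S (slice f i) (slice g (k ∸ i))
                                           (PadInv-slice f i padf) (PadInv-slice g (k ∸ i) padg) e))
               (sym (*S-∷ f g k e)))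

all-++-[_] : ∀ {p : ℕ → Bool} x → p x ≡ true → ∀ e → all p (e ++ [ x ]) ≡ all p e
all-++-[ x ] px []      = cong (_∧ true) px
all-++-[ x ] px (k ∷ e) = cong (_ ∧_) (all-++-[ x ] px e)

allZero≡all : ∀ e → allZero e ≡ all (_≡ᵇ 0) e
allZero≡all []      = refl
allZero≡all (k ∷ e) = cong ((k ≡ᵇ 0) ∧_) (allZero≡all e)

PadInv-oneS : PadInv oneS
PadInv-oneS e = cong (if_then 1ℚ else 0ℚ) (begin
  allZero (e ++ [ 0 ])     ≡⟨ allZero≡all (e ++ [ 0 ]) ⟩
  all (_≡ᵇ 0) (e ++ [ 0 ]) ≡⟨ all-++-[ 0 ] refl e ⟩
  all (_≡ᵇ 0) e            ≡⟨ allZero≡all e ⟨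
  allZero e                ∎)
  where open ≡-Reasoning

PadInv-powS : ∀ f → PadInv f → ∀ k → PadInv (powS f k)
PadInv-powS f pad zero    = PadInv-oneS
PadInv-powS f pad (suc k) = PadInv-*S f _ pad (PadInv-powS f pad k)

PadInv-monoFrom : ∀ b → (∀ n → PadInv (b n)) → ∀ i a → PadInv (monoFrom b i a)
PadInv-monoFrom b pad i []      = PadInv-oneS
PadInv-monoFrom b pad i (k ∷ a) = PadInv-*S _ _ (PadInv-powS (b i) (pad i) k) (PadInv-monoFrom b pad (suc i) a)

PadInv-scale : ∀ c f → PadInv f → PadInv (scale c f)
PadInv-scale c f pad e = cong (c ℚ.*_) (pad e)

PadInv-+S : ∀ f g → PadInv f → PadInv g → PadInv (f +S g)
PadInv-+S f g padf padg e = cong₂ ℚ._+_ (padf e) (padg e)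

PadInv-resp-≈ : ∀ {f g} → f ≈ g → PadInv f → PadInv g
PadInv-resp-≈ f≈g pad e = trans (sym (f≈g _)) (trans (pad e) (f≈g e))

PermInv-slice : ∀ f i → PermInv f → PermInv (slice f i)
PermInv-slice f i perm e e′ e↭e′ = perm (i ∷ e) (i ∷ e′) (↭.prep i e↭e′)

PermInv-swap : ∀ f → PermInv f → ∀ i j e → f (i ∷ j ∷ e) ≡ f (j ∷ i ∷ e)
PermInv-swap f perm i j e = perm _ _ (↭.swap i j ↭.refl)

-- Swapping x₀ and x₁ in the product exchanges the two summations of the iterated convolution.
PermInv-*S : ∀ f g → PermInv f → PermInv g → PermInv (f *S g)
PermInv-*S f g pf pg e .e ↭.refl = refl
PermInv-*S f g pf pg (x ∷ e) (.x ∷ e′) (↭.prep .x e↭e′) =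
  trans (*S-∷ f g x e)
        (trans (∑<-cong (suc x) (λ i _ → PermInv-*S (slice f i) (slice g (x ∸ i))
                                           (PermInv-slice f i pf) (PermInv-slice g (x ∸ i) pg) e e′ e↭e′))
               (sym (*S-∷ f g x e′)))
PermInv-*S f g pf pg (x ∷ y ∷ e) (.y ∷ .x ∷ e′) (↭.swap .x .y e↭e′) = begin
  (f *S g) (x ∷ y ∷ e)
    ≡⟨ *S-∷ f g x (y ∷ e) ⟩
  ∑< (suc x) (λ i → (slice f i *S slice g (x ∸ i)) (y ∷ e))
    ≡⟨ ∑<-cong (suc x) (λ i _ → *S-∷ (slice f i) (slice g (x ∸ i)) y e) ⟩
  ∑< (suc x) (λ i → ∑< (suc y) (λ j → term f g x y i j e))
    ≡⟨ ∑<-comm (suc x) (suc y) (λ i j → term f g x y i j e) ⟩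
  ∑< (suc y) (λ j → ∑< (suc x) (λ i → term f g x y i j e))
    ≡⟨ ∑<-cong (suc y) (λ j _ → ∑<-cong (suc x) (λ i _ → term-swap i j)) ⟩
  ∑< (suc y) (λ j → ∑< (suc x) (λ i → term f g y x j i e′))
    ≡⟨ ∑<-cong (suc y) (λ j _ → sym (*S-∷ (slice f j) (slice g (y ∸ j)) x e′)) ⟩
  ∑< (suc y) (λ j → (slice f j *S slice g (y ∸ j)) (x ∷ e′))
    ≡⟨ sym (*S-∷ f g y (x ∷ e′)) ⟩
  (f *S g) (y ∷ x ∷ e′) ∎
  where
  open ≡-Reasoning
  term : Ser → Ser → ℕ → ℕ → ℕ → ℕ → Mon → ℚ
  term φ ψ k l i j = slice (slice φ i) j *S slice (slice ψ (k ∸ i)) (l ∸ j)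
  term-swap : ∀ i j → term f g x y i j e ≡ term f g y x j i e′
  term-swap i j =
    trans (PermInv-*S _ _ (PermInv-slice _ j (PermInv-slice f i pf))
                          (PermInv-slice _ (y ∸ j) (PermInv-slice g (x ∸ i) pg)) e e′ e↭e′)
          (*S-cong (λ d → PermInv-swap f pf i j d) (λ d → PermInv-swap g pg (x ∸ i) (y ∸ j) d) e′)
PermInv-*S f g pf pg e e″ (↭.trans e↭e′ e′↭e″) =
  trans (PermInv-*S f g pf pg _ _ e↭e′) (PermInv-*S f g pf pg _ _ e′↭e″)

all-↭ : ∀ (p : ℕ → Bool) {e e′} → e ↭ e′ → all p e ≡ all p e′
all-↭ p ↭.refl                  = refl
all-↭ p (↭.prep x e↭e′)         = cong (p x ∧_) (all-↭ p e↭e′)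
all-↭ p (↭.swap {ys = e′} x y e↭e′) rewrite all-↭ p e↭e′ = begin
  p x ∧ (p y ∧ all p e′)   ≡⟨ Boolₚ.∧-assoc (p x) (p y) _ ⟨
  (p x ∧ p y) ∧ all p e′   ≡⟨ cong (_∧ all p e′) (Boolₚ.∧-comm (p x) (p y)) ⟩
  (p y ∧ p x) ∧ all p e′   ≡⟨ Boolₚ.∧-assoc (p y) (p x) _ ⟩
  p y ∧ (p x ∧ all p e′)   ∎
  where open ≡-Reasoning
all-↭ p (↭.trans e↭e′ e′↭e″)   = trans (all-↭ p e↭e′) (all-↭ p e′↭e″)

PermInv-oneS : PermInv oneS
PermInv-oneS e e′ e↭e′ = cong (if_then 1ℚ else 0ℚ)
  (trans (allZero≡all e) (trans (all-↭ (_≡ᵇ 0) e↭e′) (sym (allZero≡all e′))))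

PermInv-powS : ∀ f → PermInv f → ∀ k → PermInv (powS f k)
PermInv-powS f perm zero    = PermInv-oneS
PermInv-powS f perm (suc k) = PermInv-*S f _ perm (PermInv-powS f perm k)

PermInv-monoFrom : ∀ b → (∀ n → PermInv (b n)) → ∀ i a → PermInv (monoFrom b i a)
PermInv-monoFrom b perm i []      = PermInv-oneS
PermInv-monoFrom b perm i (k ∷ a) =
  PermInv-*S _ _ (PermInv-powS (b i) (perm i) k) (PermInv-monoFrom b perm (suc i) a)

PermInv-scale : ∀ c f → PermInv f → PermInv (scale c f)
PermInv-scale c f perm e e′ e↭e′ = cong (c ℚ.*_) (perm e e′ e↭e′)

PermInv-+S : ∀ f g → PermInv f → PermInv g → PermInv (f +S g)
PermInv-+S f g pf pg e e′ e↭e′ = cong₂ ℚ._+_ (pf e e′ e↭e′) (pg e e′ e↭e′)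

PermInv-resp-≈ : ∀ {f g} → f ≈ g → PermInv f → PermInv g
PermInv-resp-≈ f≈g perm e e′ e↭e′ = trans (sym (f≈g e)) (trans (perm e e′ e↭e′) (f≈g e′))

Homogeneous : ℕ → Ser → Set
Homogeneous n f = ∀ e → degree e ≢ n → f e ≡ 0ℚ

homogeneous-degree : ∀ {n f e} → Homogeneous n f → f e ≢ 0ℚ → degree e ≡ n
homogeneous-degree {n} {f} {e} hom fe≢0 with degree e ℕ.≟ n
... | yes eq = eq
... | no neq = ⊥-elim (fe≢0 (hom e neq))

subs-degree : ∀ e → All (λ d → degree d + degree (zipWith _∸_ e d) ≡ degree e) (subs e)
subs-degree []      = refl ∷ []
subs-degree (k ∷ e) = Allₚ.concat⁺ (Allₚ.map⁺ (Allₚ.applyUpTo⁺₁ (λ i → i) (suc k) (λ i<1+k →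
  Allₚ.map⁺ (All.map (split (ℕₚ.≤-pred i<1+k)) (subs-degree e)))))
  where
  open import Data.Nat.Solver using (module +-*-Solver)
  open +-*-Solver
  split : ∀ {i a b} → i ≤ k → a + b ≡ degree e → (i + a) + ((k ∸ i) + b) ≡ k + degree e
  split {i} {a} {b} i≤k a+b≡e = begin
    (i + a) + ((k ∸ i) + b) ≡⟨ solve 4 (λ i a m b → (i :+ a) :+ (m :+ b) := (i :+ m) :+ (a :+ b)) refl i a (k ∸ i) b ⟩
    (i + (k ∸ i)) + (a + b) ≡⟨ cong₂ _+_ (ℕₚ.m+[n∸m]≡n i≤k) a+b≡e ⟩
    k + degree e            ∎
    where open ≡-Reasoning

*S-homogeneous : ∀ {m n} f g → Homogeneous m f → Homogeneous n g → Homogeneous (m + n) (f *S g)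
*S-homogeneous {m} {n} f g homf homg e deg≢m+n = ∑-zeroᴬ {xs = subs e} (All.map term≡0 (subs-degree e))
  where
  term≡0 : ∀ {d} → degree d + degree (zipWith _∸_ e d) ≡ degree e → f d ℚ.* g (zipWith _∸_ e d) ≡ 0ℚ
  term≡0 {d} split with degree d ℕ.≟ m
  ... | no  d≢m = trans (cong (ℚ._* g (zipWith _∸_ e d)) (homf d d≢m)) (ℚₚ.*-zeroˡ (g (zipWith _∸_ e d)))
  ... | yes d≡m = trans (cong (f d ℚ.*_) (homg _ (λ r≡n → deg≢m+n (trans (sym split) (cong₂ _+_ d≡m r≡n)))))
                        (ℚₚ.*-zeroʳ (f d))

allZero⇒degree≡0 : ∀ e → allZero e ≡ true → degree e ≡ 0
allZero⇒degree≡0 []            _  = refl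
allZero⇒degree≡0 (zero ∷ e)    az = allZero⇒degree≡0 e az

oneS-homogeneous : Homogeneous 0 oneS
oneS-homogeneous e deg≢0 with allZero e in az
... | true  = ⊥-elim (deg≢0 (allZero⇒degree≡0 e az))
... | false = refl

powS-homogeneous : ∀ {n} f → Homogeneous n f → ∀ k → Homogeneous (k * n) (powS f k)
powS-homogeneous f hom zero    = oneS-homogeneous
powS-homogeneous f hom (suc k) = *S-homogeneous f _ hom (powS-homogeneous f hom k)

weightFrom : (ℕ → ℕ) → ℕ → List ℕ → ℕ
weightFrom w i []      = 0
weightFrom w i (k ∷ a) = k * w i + weightFrom w (suc i) a

monoFrom-homogeneous : ∀ b (w : ℕ → ℕ) → (∀ i → Homogeneous (w i) (b i)) →
                       ∀ i a → Homogeneous (weightFrom w i a) (monoFrom b i a)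
monoFrom-homogeneous b w hom i []      = oneS-homogeneous
monoFrom-homogeneous b w hom i (k ∷ a) =
  *S-homogeneous _ _ (powS-homogeneous (b i) (hom i) k) (monoFrom-homogeneous b w hom (suc i) a)

-- The padded lexicographic order

hd : Mon → ℕ
hd []      = 0
hd (k ∷ _) = k

tl : Mon → Mon
tl []      = []
tl (_ ∷ e) = e

at : Mon → ℕ → ℕ
at []      j       = 0
at (k ∷ e) zero    = k
at (k ∷ e) (suc j) = at e j

at-hd : ∀ α → at α 0 ≡ hd α
at-hd []      = refl
at-hd (_ ∷ _) = refl

at-tl : ∀ α j → at α (suc j) ≡ at (tl α) j
at-tl []      j = refl
at-tl (_ ∷ _) j = refl

-- Exponent lists are compared as the infinite sequences they denote, [] being all zeros.
infix 4 _≋_ _<ₗ_ _≤ₗ_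

record _≋_ (α β : Mon) : Set where
  constructor mk≋
  field ≋-at : ∀ j → at α j ≡ at β j
open _≋_

data _<ₗ_ : Mon → Mon → Set where
  head< : ∀ {α β} → hd α < hd β → α <ₗ β
  tail< : ∀ {α β} → hd α ≡ hd β → tl α <ₗ tl β → α <ₗ β

_≤ₗ_ : Mon → Mon → Set
α ≤ₗ β = α <ₗ β ⊎ α ≋ β

≋-sym : ∀ {α β} → α ≋ β → β ≋ α
≋-sym α≋β = mk≋ (λ j → sym (≋-at α≋β j))

≋-refl : ∀ {α} → α ≋ α
≋-refl = mk≋ (λ _ → refl)

≋-hd : ∀ {α β} → α ≋ β → hd α ≡ hd β
≋-hd {α} {β} α≋β = trans (sym (at-hd α)) (trans (≋-at α≋β 0) (at-hd β))

≋-tl : ∀ {α β} → α ≋ β → tl α ≋ tl β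
≋-tl {α} {β} α≋β = mk≋ (λ j → trans (sym (at-tl α j)) (trans (≋-at α≋β (suc j)) (at-tl β j)))

hd-tl-≋ : ∀ {α β} → hd α ≡ hd β → tl α ≋ tl β → α ≋ β
hd-tl-≋ {α} {β} hd≡ tl≋ = mk≋ λ where
  zero    → trans (at-hd α) (trans hd≡ (sym (at-hd β)))
  (suc j) → trans (at-tl α j) (trans (≋-at tl≋ j) (sym (at-tl β j)))

<ₗ-irrefl : ∀ {α β} → α ≋ β → ¬ α <ₗ β
<ₗ-irrefl α≋β (head< lt)   = ℕₚ.<-irrefl (≋-hd α≋β) lt
<ₗ-irrefl α≋β (tail< _ lt) = <ₗ-irrefl (≋-tl α≋β) lt

<ₗ-trans : ∀ {α β γ} → α <ₗ β → β <ₗ γ → α <ₗ γ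
<ₗ-trans (head< p)   (head< q)   = head< (ℕₚ.<-trans p q)
<ₗ-trans (head< p)   (tail< q _) = head< (subst (_ <_) q p)
<ₗ-trans (tail< p _) (head< q)   = head< (subst (_< _) (sym p) q)
<ₗ-trans (tail< p r) (tail< q s) = tail< (trans p q) (<ₗ-trans r s)

<ₗ-asym : ∀ {α β} → α <ₗ β → ¬ β <ₗ α
<ₗ-asym {α} α<β β<α = <ₗ-irrefl {α} (mk≋ (λ _ → refl)) (<ₗ-trans α<β β<α)

<ₗ-respˡ-≋ : ∀ {α α′ β} → α ≋ α′ → α <ₗ β → α′ <ₗ β
<ₗ-respˡ-≋ α≋α′ (head< p)   = head< (subst (_< _) (≋-hd α≋α′) p)
<ₗ-respˡ-≋ α≋α′ (tail< p q) = tail< (trans (sym (≋-hd α≋α′)) p) (<ₗ-respˡ-≋ (≋-tl α≋α′) q)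

≤ₗ-<ₗ-trans : ∀ {α β γ} → α ≤ₗ β → β <ₗ γ → α <ₗ γ
≤ₗ-<ₗ-trans (inj₁ α<β) β<γ = <ₗ-trans α<β β<γ
≤ₗ-<ₗ-trans (inj₂ α≋β) β<γ = <ₗ-respˡ-≋ (≋-sym α≋β) β<γ

≮ₗ[] : ∀ {α} → ¬ α <ₗ []
≮ₗ[] (tail< _ lt) = ≮ₗ[] lt

Compareₗ : Mon → Mon → Set
Compareₗ α β = α <ₗ β ⊎ α ≋ β ⊎ β <ₗ α

compareₗ-step : ∀ α β → Compareₗ (tl α) (tl β) → Compareₗ α β
compareₗ-step α β tl-cmp with ℕₚ.<-cmp (hd α) (hd β) | tl-cmp
... | tri< lt _ _ | _                  = inj₁ (head< lt)
... | tri> _ _ gt | _                  = inj₂ (inj₂ (head< gt))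
... | tri≈ _ eq _ | inj₁ lt            = inj₁ (tail< eq lt)
... | tri≈ _ eq _ | inj₂ (inj₁ tl≋)    = inj₂ (inj₁ (hd-tl-≋ eq tl≋))
... | tri≈ _ eq _ | inj₂ (inj₂ gt)     = inj₂ (inj₂ (tail< (sym eq) gt))

compareₗ : ∀ α β → Compareₗ α β
compareₗ []      []      = inj₂ (inj₁ ≋-refl)
compareₗ []      (y ∷ β) = compareₗ-step [] (y ∷ β) (compareₗ [] β)
compareₗ (x ∷ α) []      = compareₗ-step (x ∷ α) [] (compareₗ α [])
compareₗ (x ∷ α) (y ∷ β) = compareₗ-step (x ∷ α) (y ∷ β) (compareₗ α β)

<ₗ-or-≥ : ∀ α β → α <ₗ β ⊎ β ≤ₗ α
<ₗ-or-≥ α β with compareₗ α β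
... | inj₁ α<β        = inj₁ α<β
... | inj₂ (inj₁ α≋β) = inj₂ (inj₂ (≋-sym α≋β))
... | inj₂ (inj₂ β<α) = inj₂ (inj₁ β<α)

≋-cong : ∀ {α β} f → PadInv f → α ≋ β → f α ≡ f β
≋-cong {[]}    {[]}    f pad α≋β = refl
≋-cong {[]}    {y ∷ β} f pad α≋β =
  trans (sym (pad [])) (trans (≋-cong {[]} {β} (slice f 0) (PadInv-slice f 0 pad) (≋-tl α≋β))
                              (cong (λ k → f (k ∷ β)) (≋-at α≋β 0)))
≋-cong {x ∷ α} {[]}    f pad α≋β =
  trans (cong (λ k → f (k ∷ α)) (≋-at α≋β 0))
        (trans (≋-cong {α} {[]} (slice f 0) (PadInv-slice f 0 pad) (≋-tl α≋β)) (pad []))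
≋-cong {x ∷ α} {y ∷ β} f pad α≋β =
  trans (≋-cong {α} {β} (slice f x) (PadInv-slice f x pad) (≋-tl α≋β)) (cong (λ k → f (k ∷ β)) (≋-at α≋β 0))

≋-degree : ∀ {α β} → α ≋ β → degree α ≡ degree β
≋-degree {[]}    {[]}    α≋β = refl
≋-degree {[]}    {y ∷ β} α≋β = cong₂ _+_ (≋-at α≋β 0) (≋-degree {[]} {β} (≋-tl α≋β))
≋-degree {x ∷ α} {[]}    α≋β = cong₂ _+_ (≋-at α≋β 0) (≋-degree {α} {[]} (≋-tl α≋β))
≋-degree {x ∷ α} {y ∷ β} α≋β = cong₂ _+_ (≋-at α≋β 0) (≋-degree {α} {β} (≋-tl α≋β))

≋-length⇒≡ : ∀ {α β} → length α ≡ length β → α ≋ β → α ≡ β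
≋-length⇒≡ {[]}    {[]}    _   _   = refl
≋-length⇒≡ {x ∷ α} {y ∷ β} len α≋β = cong₂ _∷_ (≋-at α≋β 0) (≋-length⇒≡ (ℕₚ.suc-injective len) (≋-tl α≋β))

module _ {A : Set} (key : A → Mon) {P : A → Set} (P? : ∀ x → Dec (P x)) where

  LexMaximal : List A → A → Set
  LexMaximal xs x = All (λ y → P y → ¬ key x <ₗ key y) xs

  lexMaximal : ∀ xs → Any P xs → ∃ λ x → x ∈ xs × P x × LexMaximal xs x
  lexMaximal (x ∷ xs) any with P? x | any
  ... | no ¬px | here px    = ⊥-elim (¬px px)
  ... | no ¬px | there any′ with lexMaximal xs any′
  ...   | m , m∈xs , pm , max = m , there m∈xs , pm , (λ px → ⊥-elim (¬px px)) ∷ max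
  lexMaximal (x ∷ xs) any | yes px | _ with Any.any? P? xs
  ... | no none = x , here refl , px , (λ _ → <ₗ-irrefl ≋-refl)
                                     ∷ All.tabulate (λ y∈xs py → ⊥-elim (none (lose y∈xs py)))
  ... | yes any′ with lexMaximal xs any′
  ...   | m , m∈xs , pm , max with <ₗ-or-≥ (key x) (key m)
  ...     | inj₁ x<m = m , there m∈xs , pm , (λ _ m<x → <ₗ-asym x<m m<x) ∷ max
  ...     | inj₂ m≤x = x , here refl , px , (λ _ → <ₗ-irrefl ≋-refl)
                         ∷ All.map (λ ¬m<y py x<y → ¬m<y py (≤ₗ-<ₗ-trans m≤x x<y)) max

-- Leading monomials

Support≤ₗ : Ser → Mon → Set
Support≤ₗ f α = ∀ e → α <ₗ e → f e ≡ 0ℚ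

infixl 6 _⊕_

_⊕_ : Mon → Mon → Mon
[]      ⊕ β       = β
(x ∷ α) ⊕ []      = x ∷ α
(x ∷ α) ⊕ (y ∷ β) = (x + y) ∷ (α ⊕ β)

⊕-identityʳ : ∀ α → α ⊕ [] ≡ α
⊕-identityʳ []      = refl
⊕-identityʳ (_ ∷ _) = refl

hd-⊕ : ∀ α β → hd (α ⊕ β) ≡ hd α + hd β
hd-⊕ []      β       = refl
hd-⊕ (x ∷ α) []      = sym (ℕₚ.+-identityʳ x)
hd-⊕ (x ∷ α) (y ∷ β) = refl

tl-⊕ : ∀ α β → tl (α ⊕ β) ≡ tl α ⊕ tl β
tl-⊕ []      β       = refl
tl-⊕ (x ∷ α) []      = sym (⊕-identityʳ α)
tl-⊕ (x ∷ α) (y ∷ β) = refl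

_⊗_ : ℕ → Mon → Mon
zero  ⊗ α = []
suc k ⊗ α = α ⊕ (k ⊗ α)

PadInv-hd-tl : ∀ {f} → PadInv f → ∀ α → f α ≡ f (hd α ∷ tl α)
PadInv-hd-tl pad []      = sym (pad [])
PadInv-hd-tl pad (_ ∷ _) = refl

Support≤ₗ-slice : ∀ {f α} → Support≤ₗ f α → Support≤ₗ (slice f (hd α)) (tl α)
Support≤ₗ-slice {α = α} supp e lt = supp (hd α ∷ e) (tail< refl lt)

Support≤ₗ-head : ∀ {f α i} → Support≤ₗ f α → hd α < i → ∀ e → f (i ∷ e) ≡ 0ℚ
Support≤ₗ-head {i = i} supp lt e = supp (i ∷ e) (head< lt)

module _ {f g : Ser} {α β : Mon} (suppf : Support≤ₗ f α) (suppg : Support≤ₗ g β) where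

  *S-∷-term-zero : ∀ {k i} e → hd α < i ⊎ i + hd β < k → (slice f i *S slice g (k ∸ i)) e ≡ 0ℚ
  *S-∷-term-zero {k} {i} e (inj₁ hdα<i) = *S-zeroˡ (slice f i) (slice g (k ∸ i)) (Support≤ₗ-head suppf hdα<i) e
  *S-∷-term-zero {k} {i} e (inj₂ i+hdβ<k) = *S-zeroʳ (slice f i) (slice g (k ∸ i)) (Support≤ₗ-head suppg hdβ<k∸i) e
    where
    hdβ<k∸i : hd β < k ∸ i
    hdβ<k∸i = subst (_< k ∸ i) (ℕₚ.m+n∸m≡n i (hd β)) (ℕₚ.∸-monoˡ-< i+hdβ<k (ℕₚ.m≤m+n i (hd β)))

  *S-∷-leading : ∀ e → (f *S g) ((hd α + hd β) ∷ e) ≡ (slice f (hd α) *S slice g (hd β)) e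
  *S-∷-leading e = begin
    (f *S g) ((hd α + hd β) ∷ e)
      ≡⟨ *S-∷ f g _ e ⟩
    ∑< (suc (hd α + hd β)) (λ i → (slice f i *S slice g (hd α + hd β ∸ i)) e)
      ≡⟨ ∑<-single _ (hd α) (s≤s (ℕₚ.m≤m+n (hd α) (hd β))) other-zero ⟩
    (slice f (hd α) *S slice g (hd α + hd β ∸ hd α)) e
      ≡⟨ cong (λ k → (slice f (hd α) *S slice g k) e) (ℕₚ.m+n∸m≡n (hd α) (hd β)) ⟩
    (slice f (hd α) *S slice g (hd β)) e ∎
    where
    open ≡-Reasoning
    other-zero : ∀ i → i ≢ hd α → (slice f i *S slice g (hd α + hd β ∸ i)) e ≡ 0ℚ
    other-zero i i≢hdα with ℕₚ.<-cmp i (hd α)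
    ... | tri< i<hdα _ _ = *S-∷-term-zero e (inj₂ (ℕₚ.+-monoˡ-< (hd β) i<hdα))
    ... | tri≈ _ i≡hdα _ = ⊥-elim (i≢hdα i≡hdα)
    ... | tri> _ _ hdα<i = *S-∷-term-zero e (inj₁ hdα<i)

*S-Support≤ₗ : ∀ {f g α β} → Support≤ₗ f α → Support≤ₗ g β → Support≤ₗ (f *S g) (α ⊕ β)
*S-Support≤ₗ suppf suppg []      lt = ⊥-elim (≮ₗ[] lt)
*S-Support≤ₗ {f} {g} {α} {β} suppf suppg (k ∷ e) (head< lt) =
  trans (*S-∷ f g k e) (∑<-zero (suc k) (λ i _ → *S-∷-term-zero suppf suppg e (case i)))
  where
  hdα+hdβ<k : hd α + hd β < k
  hdα+hdβ<k = subst (_< k) (hd-⊕ α β) lt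
  case : ∀ i → hd α < i ⊎ i + hd β < k
  case i with ℕₚ.≤-<-connex i (hd α)
  ... | inj₁ i≤hdα = inj₂ (ℕₚ.≤-<-trans (ℕₚ.+-monoˡ-≤ (hd β) i≤hdα) hdα+hdβ<k)
  ... | inj₂ hdα<i = inj₁ hdα<i
*S-Support≤ₗ {f} {g} {α} {β} suppf suppg (k ∷ e) (tail< hd≡k lt)
  rewrite sym (trans (sym (hd-⊕ α β)) hd≡k) =
  trans (*S-∷-leading suppf suppg e)
        (*S-Support≤ₗ (Support≤ₗ-slice suppf) (Support≤ₗ-slice suppg) e (subst (_<ₗ e) (tl-⊕ α β) lt))

*S-leading-step : ∀ {f g} α β → PadInv f → PadInv g → Support≤ₗ f α → Support≤ₗ g β →
                  (slice f (hd α) *S slice g (hd β)) (tl α ⊕ tl β) ≡ f (hd α ∷ tl α) ℚ.* g (hd β ∷ tl β) →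
                  (f *S g) ((hd α + hd β) ∷ (tl α ⊕ tl β)) ≡ f α ℚ.* g β
*S-leading-step α β padf padg suppf suppg tails =
  trans (*S-∷-leading suppf suppg (tl α ⊕ tl β))
        (trans tails (sym (cong₂ ℚ._*_ (PadInv-hd-tl padf α) (PadInv-hd-tl padg β))))

*S-leading : ∀ {f g} α β → PadInv f → PadInv g → Support≤ₗ f α → Support≤ₗ g β →
             (f *S g) (α ⊕ β) ≡ f α ℚ.* g β
*S-leading {f} {g} []      []      padf padg suppf suppg = *S-[] f g
*S-leading {f} {g} []      (y ∷ β) padf padg suppf suppg = *S-leading-step [] (y ∷ β) padf padg suppf suppg
  (*S-leading [] β (PadInv-slice f 0 padf) (PadInv-slice g y padg) (Support≤ₗ-slice suppf) (Support≤ₗ-slice suppg))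
*S-leading {f} {g} (x ∷ α) []      padf padg suppf suppg =
  trans (cong (f *S g) (cong₂ _∷_ (sym (ℕₚ.+-identityʳ x)) (sym (⊕-identityʳ α))))
        (*S-leading-step (x ∷ α) [] padf padg suppf suppg
          (*S-leading α [] (PadInv-slice f x padf) (PadInv-slice g 0 padg) (Support≤ₗ-slice suppf) (Support≤ₗ-slice suppg)))
*S-leading {f} {g} (x ∷ α) (y ∷ β) padf padg suppf suppg = *S-leading-step (x ∷ α) (y ∷ β) padf padg suppf suppg
  (*S-leading α β (PadInv-slice f x padf) (PadInv-slice g y padg) (Support≤ₗ-slice suppf) (Support≤ₗ-slice suppg))

allZero⇒[]≋ : ∀ e → allZero e ≡ true → [] ≋ e
allZero⇒[]≋ []         _  = ≋-refl
allZero⇒[]≋ (zero ∷ e) az = mk≋ λ where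
  zero    → refl
  (suc j) → ≋-at (allZero⇒[]≋ e az) j

oneS-Support≤ₗ : Support≤ₗ oneS []
oneS-Support≤ₗ e lt with allZero e in az
... | true  = ⊥-elim (<ₗ-irrefl (allZero⇒[]≋ e az) lt)
... | false = refl

powS-Support≤ₗ : ∀ {f α} → Support≤ₗ f α → ∀ k → Support≤ₗ (powS f k) (k ⊗ α)
powS-Support≤ₗ supp zero    = oneS-Support≤ₗ
powS-Support≤ₗ supp (suc k) = *S-Support≤ₗ supp (powS-Support≤ₗ supp k)

powS-leading-pos : ∀ {f} α → PadInv f → Support≤ₗ f α → Positive (f α) → ∀ k → Positive (powS f k (k ⊗ α))
powS-leading-pos α pad supp pos zero    = _
powS-leading-pos {f} α pad supp pos (suc k) =
  subst Positive (sym (*S-leading α (k ⊗ α) pad (PadInv-powS f pad k) supp (powS-Support≤ₗ supp k)))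
        (ℚₚ.pos*pos⇒pos (f α) {{pos}} (powS f k (k ⊗ α)) {{powS-leading-pos α pad supp pos k}})

leadingFrom : (ℕ → Mon) → ℕ → List ℕ → Mon
leadingFrom β i []      = []
leadingFrom β i (k ∷ a) = (k ⊗ β i) ⊕ leadingFrom β (suc i) a

module Monomials (b : ℕ → Ser) (β : ℕ → Mon) (pad : ∀ n → PadInv (b n))
                 (supp : ∀ n → Support≤ₗ (b n) (β n)) (pos : ∀ n → Positive (b n (β n))) where

  monoFrom-Support≤ₗ : ∀ i a → Support≤ₗ (monoFrom b i a) (leadingFrom β i a)
  monoFrom-Support≤ₗ i []      = oneS-Support≤ₗ
  monoFrom-Support≤ₗ i (k ∷ a) = *S-Support≤ₗ (powS-Support≤ₗ (supp i) k) (monoFrom-Support≤ₗ (suc i) a)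

  monoFrom-leading-pos : ∀ i a → Positive (monoFrom b i a (leadingFrom β i a))
  monoFrom-leading-pos i []      = _
  monoFrom-leading-pos i (k ∷ a) =
    subst Positive (sym (*S-leading (k ⊗ β i) (leadingFrom β (suc i) a)
                          (PadInv-powS (b i) (pad i) k) (PadInv-monoFrom b pad (suc i) a)
                          (powS-Support≤ₗ (supp i) k) (monoFrom-Support≤ₗ (suc i) a)))
          (ℚₚ.pos*pos⇒pos (powS (b i) k (k ⊗ β i)) {{powS-leading-pos (β i) (pad i) (supp i) (pos i) k}}
                          (monoFrom b (suc i) a (leadingFrom β (suc i) a)) {{monoFrom-leading-pos (suc i) a}})

≡ᵇ-true⇒≡ : ∀ {m n} → (m ≡ᵇ n) ≡ true → m ≡ n
≡ᵇ-true⇒≡ {m} {n} eq = ℕₚ.≡ᵇ⇒≡ m n (Equivalence.from T-≡ eq)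

squarefree : Mon → Bool
squarefree = all (_≤ᵇ 1)

elementary : ℕ → Ser
elementary m e = if (degree e ≡ᵇ m) ∧ squarefree e then 1ℚ else 0ℚ

ones : ℕ → Mon
ones m = replicate m 1

degree-++[0] : ∀ e → degree (e ++ [ 0 ]) ≡ degree e
degree-++[0] e = trans (ListAction.sum-++ e [ 0 ]) (ℕₚ.+-identityʳ _)

PadInv-elementary : ∀ m → PadInv (elementary m)
PadInv-elementary m e rewrite degree-++[0] e | all-++-[_] {_≤ᵇ 1} 0 refl e = refl

PermInv-elementary : ∀ m → PermInv (elementary m)
PermInv-elementary m e e′ e↭e′ rewrite ListAction.sum-↭ e↭e′ | all-↭ (_≤ᵇ 1) e↭e′ = refl

elementary-homogeneous : ∀ m → Homogeneous m (elementary m)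
elementary-homogeneous m e deg≢m with degree e ≡ᵇ m in eq
... | true  = ⊥-elim (deg≢m (≡ᵇ-true⇒≡ eq))
... | false = refl

ones-≮ₗ : ∀ m e → squarefree e ≡ true → degree e ≡ m → ¬ ones m <ₗ e
ones-≮ₗ zero    e                  sf deg lt = <ₗ-irrefl (allZero⇒[]≋ e (degree≡0⇒allZero e deg)) lt
  where
  degree≡0⇒allZero : ∀ e → degree e ≡ 0 → allZero e ≡ true
  degree≡0⇒allZero []         _   = refl
  degree≡0⇒allZero (zero ∷ e) deg = degree≡0⇒allZero e deg
ones-≮ₗ (suc m) (zero ∷ e)         sf deg (head< ())
ones-≮ₗ (suc m) (zero ∷ e)         sf deg (tail< () _)
ones-≮ₗ (suc m) (suc zero ∷ e)     sf deg (head< (s≤s ()))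
ones-≮ₗ (suc m) (suc zero ∷ e)     sf deg (tail< _ lt) = ones-≮ₗ m e sf (ℕₚ.suc-injective deg) lt

elementary-Support≤ₗ : ∀ m → Support≤ₗ (elementary m) (ones m)
elementary-Support≤ₗ m e lt with degree e ≡ᵇ m in deg | squarefree e in sf
... | true  | true  = ⊥-elim (ones-≮ₗ m e sf (≡ᵇ-true⇒≡ deg) lt)
... | true  | false = refl
... | false | _     = refl

degree-ones : ∀ m → degree (ones m) ≡ m
degree-ones zero    = refl
degree-ones (suc m) = cong suc (degree-ones m)

squarefree-ones : ∀ m → squarefree (ones m) ≡ true
squarefree-ones zero    = refl
squarefree-ones (suc m) = squarefree-ones m

elementary-ones : ∀ m → elementary m (ones m) ≡ 1ℚ
elementary-ones m = cong₂ (λ x y → if x ∧ y then 1ℚ else 0ℚ)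
  (trans (cong (_≡ᵇ m) (degree-ones m)) (Equivalence.to T-≡ (ℕₚ.≡⇒≡ᵇ m m refl))) (squarefree-ones m)

-- The Redei–Berge function of a complete digraph

increasing : List ℕ → Bool
increasing (i ∷ j ∷ is) = (i <ᵇ j) ∧ increasing (j ∷ is)
increasing _            = true

strictAt-all : ∀ is → strictAt (replicate (length is ∸ 1) true) is ≡ increasing is
strictAt-all []           = refl
strictAt-all (i ∷ [])     = refl
strictAt-all (i ∷ j ∷ is) = cong ((i <ᵇ j) ∧_) (strictAt-all (j ∷ is))

idxFrom-≥ : ∀ i e → All (i ≤_) (idxFrom i e)
idxFrom-≥ i []      = []
idxFrom-≥ i (k ∷ e) = Allₚ.++⁺ (Allₚ.replicate⁺ k ℕₚ.≤-refl) (All.map (ℕₚ.<⇒≤) (idxFrom-≥ (suc i) e))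

increasing-∷ : ∀ i is → All (i <_) is → increasing (i ∷ is) ≡ increasing is
increasing-∷ i []       _          = refl
increasing-∷ i (j ∷ is) (i<j ∷ _) = cong (_∧ increasing (j ∷ is)) (Equivalence.to T-≡ (ℕₚ.<⇒<ᵇ i<j))

increasing-idxFrom : ∀ i e → increasing (idxFrom i e) ≡ squarefree e
increasing-idxFrom i []                 = refl
increasing-idxFrom i (zero ∷ e)         = increasing-idxFrom (suc i) e
increasing-idxFrom i (suc zero ∷ e)     =
  trans (increasing-∷ i _ (idxFrom-≥ (suc i) e)) (increasing-idxFrom (suc i) e)
increasing-idxFrom i (suc (suc k) ∷ e) = cong (_∧ increasing (i ∷ idxFrom i (k ∷ e))) (<ᵇ-irrefl i)
  where
  <ᵇ-irrefl : ∀ i → (i <ᵇ i) ≡ false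
  <ᵇ-irrefl zero    = refl
  <ᵇ-irrefl (suc i) = <ᵇ-irrefl i

length-idxFrom : ∀ i e → length (idxFrom i e) ≡ degree e
length-idxFrom i []      = refl
length-idxFrom i (k ∷ e) =
  trans (Listₚ.length-++ (replicate k i)) (cong₂ _+_ (Listₚ.length-replicate k) (length-idxFrom (suc i) e))

F-all≈elementary : ∀ m → F m (replicate (m ∸ 1) true) ≈ elementary m
F-all≈elementary m e rewrite length-idxFrom 0 e with degree e ≡ᵇ m in eq
... | false = refl
... | true  = cong (if_then 1ℚ else 0ℚ) (begin
  strictAt (replicate (m ∸ 1) true) (idx e)
    ≡⟨ cong (λ n → strictAt (replicate (n ∸ 1) true) (idx e)) length≡m ⟨
  strictAt (replicate (length (idx e) ∸ 1) true) (idx e)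
    ≡⟨ strictAt-all (idx e) ⟩
  increasing (idx e)
    ≡⟨ increasing-idxFrom 0 e ⟩
  squarefree e ∎)
  where
  open ≡-Reasoning
  length≡m : length (idx e) ≡ m
  length≡m = trans (length-idxFrom 0 e) (≡ᵇ-true⇒≡ eq)

complete : ℕ → Digraph
complete m = record { size = m ; edge = λ u v → not (does (u Finₚ.≟ v)) }

complete-loopless : ∀ m → Loopless (complete m)
complete-loopless m v with v Finₚ.≟ v
... | yes _   = refl
... | no v≢v = ⊥-elim (v≢v refl)

xdes-complete : ∀ m (π : List (Fin m)) → Unique π → xdes (complete m) π ≡ replicate (length π ∸ 1) true
xdes-complete m []          _                   = refl
xdes-complete m (u ∷ [])    _                   = refl
xdes-complete m (u ∷ v ∷ π) ((u≢v ∷ _) ∷ uniq) with u Finₚ.≟ v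
... | yes u≡v = ⊥-elim (u≢v u≡v)
... | no  _   = cong (true ∷_) (xdes-complete m (v ∷ π) uniq)

length-allLists : {A : Set} → ∀ n (xs : List A) → All (λ π → length π ≡ n) (allLists n xs)
length-allLists zero    xs = refl ∷ []
length-allLists (suc n) xs = Allₚ.concat⁺ (Allₚ.map⁺ (All.tabulate {xs = xs} (λ {u} _ →
  Allₚ.map⁺ {f = u ∷_} (All.map (cong suc) (length-allLists n xs)))))

listings-valid : ∀ n → All (λ π → length π ≡ n × Unique π) (listings n)
listings-valid n = All.zip ( Allₚ.filter⁺ _ (length-allLists n (allFin n))
                           , Allₚ.all-filter (UniqueDec.unique? Finₚ._≟_) (allLists n (allFin n)))

∈-allLists : {A : Set} → ∀ n (xs π : List A) → length π ≡ n → All (_∈ xs) π → π ∈ allLists n xs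
∈-allLists zero    xs []      refl []          = here refl
∈-allLists (suc n) xs (u ∷ π) len  (u∈xs ∷ π⊆xs) = ∈ₚ.∈-concat⁺′ (∈ₚ.∈-map⁺ (u ∷_) π∈) (∈ₚ.∈-map⁺ _ u∈xs)
  where π∈ = ∈-allLists n xs π (ℕₚ.suc-injective len) π⊆xs

allFin∈listings : ∀ n → allFin n ∈ listings n
allFin∈listings n = ∈ₚ.∈-filter⁺ (UniqueDec.unique? Finₚ._≟_)
  (∈-allLists n (allFin n) (allFin n) (Listₚ.length-tabulate _) (All.tabulate (λ {u} _ → ∈ₚ.∈-allFin u)))
  (Uniqueₚ.allFin⁺ n)

U-complete : ∀ m → U (complete m) ≈ scale (count (listings m)) (elementary m)
U-complete m e = begin
  U (complete m) e
    ≡⟨ sumS-map (λ π → F m (xdes (complete m) π)) (listings m) e ⟩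
  ∑ (λ π → F m (xdes (complete m) π) e) (listings m)
    ≡⟨ ∑-congᴬ (All.map F≡elementary (listings-valid m)) ⟩
  ∑ (λ _ → elementary m e) (listings m)
    ≡⟨ ∑-const (elementary m e) (listings m) ⟩
  count (listings m) ℚ.* elementary m e ∎
  where
  open ≡-Reasoning
  F≡elementary : ∀ {π} → length π ≡ m × Unique π → F m (xdes (complete m) π) e ≡ elementary m e
  F≡elementary {π} (len≡m , uniq) rewrite xdes-complete m π uniq | len≡m = F-all≈elementary m e

𝟙 : Bool → ℕ
𝟙 true  = 1
𝟙 false = 0

at-⊕ : ∀ α β j → at (α ⊕ β) j ≡ at α j + at β j
at-⊕ []      β       j       = refl
at-⊕ (x ∷ α) []      j       = sym (ℕₚ.+-identityʳ _)
at-⊕ (x ∷ α) (y ∷ β) zero    = refl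
at-⊕ (x ∷ α) (y ∷ β) (suc j) = at-⊕ α β j

at-⊗ : ∀ k α j → at (k ⊗ α) j ≡ k * at α j
at-⊗ zero    α j = refl
at-⊗ (suc k) α j = trans (at-⊕ α (k ⊗ α) j) (cong (at α j +_) (at-⊗ k α j))

at-ones : ∀ m j → at (ones m) j ≡ 𝟙 (j <ᵇ m)
at-ones zero    j       = refl
at-ones (suc m) zero    = refl
at-ones (suc m) (suc j) = at-ones m j

at-≥length : ∀ α j → length α ≤ j → at α j ≡ 0
at-≥length []      j       _         = refl
at-≥length (x ∷ α) (suc j) (s≤s α≤j) = at-≥length α j α≤j

at-applyUpTo : ∀ (f : ℕ → ℕ) n m → m < n → at (applyUpTo f n) m ≡ f m
at-applyUpTo f (suc n) zero    _         = refl
at-applyUpTo f (suc n) (suc m) (s≤s m<n) = at-applyUpTo (f ∘ suc) n m m<n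

at-applyUpTo-≥ : ∀ (f : ℕ → ℕ) n m → n ≤ m → at (applyUpTo f n) m ≡ 0
at-applyUpTo-≥ f n m n≤m = at-≥length (applyUpTo f n) m (subst (_≤ m) (sym (Listₚ.length-applyUpTo f n)) n≤m)

-- `trim α` drops the trailing zeros, giving the canonical representative of the ≋-class of α.
infixr 5 _∷′_

_∷′_ : ℕ → Mon → Mon
x     ∷′ y ∷ α = x ∷ y ∷ α
zero  ∷′ []    = []
suc k ∷′ []    = [ suc k ]

trim : Mon → Mon
trim = foldr _∷′_ []

trim-≋ : ∀ α → trim α ≋ α
trim-≋ []      = ≋-refl
trim-≋ (x ∷ α) = mk≋ (∷′-at x (trim α) (trim-≋ α))
  where
  ∷′-at : ∀ x r → r ≋ α → ∀ j → at (x ∷′ r) j ≡ at (x ∷ α) j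
  ∷′-at zero    []      r≋α zero    = refl
  ∷′-at zero    []      r≋α (suc j) = ≋-at r≋α j
  ∷′-at (suc k) []      r≋α zero    = refl
  ∷′-at (suc k) []      r≋α (suc j) = ≋-at r≋α j
  ∷′-at x       (y ∷ r) r≋α zero    = refl
  ∷′-at x       (y ∷ r) r≋α (suc j) = ≋-at r≋α j

length-trim : ∀ α → length (trim α) ≤ length α
length-trim []      = z≤n
length-trim (x ∷ α) = ℕₚ.≤-trans (length-∷′ x (trim α)) (s≤s (length-trim α))
  where
  length-∷′ : ∀ x r → length (x ∷′ r) ≤ suc (length r)
  length-∷′ x       (y ∷ r) = ℕₚ.≤-refl
  length-∷′ zero    []      = z≤n
  length-∷′ (suc k) []      = ℕₚ.≤-refl

Canon-trim : ∀ α → Canon (trim α)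
Canon-trim []      = canon[]
Canon-trim (x ∷ α) = Canon-∷′ x (trim α) (Canon-trim α)
  where
  Canon-∷′ : ∀ x r → Canon r → Canon (x ∷′ r)
  Canon-∷′ zero    []      _ = canon[]
  Canon-∷′ (suc k) []      _ = canon1 (suc k) (λ ())
  Canon-∷′ x       (y ∷ r) c = canon∷ x (y ∷ r) (λ ()) c

trim-Canon : ∀ {a} → Canon a → trim a ≡ a
trim-Canon canon[]                  = refl
trim-Canon (canon1 zero 0≢0)        = ⊥-elim (0≢0 refl)
trim-Canon (canon1 (suc k) _)       = refl
trim-Canon (canon∷ k [] []≢[] _)    = ⊥-elim ([]≢[] refl)
trim-Canon (canon∷ k (y ∷ a) _ c)   = cong (k ∷′_) (trim-Canon c)

≋⇒trim≡ : ∀ {α β} → α ≋ β → trim α ≡ trim β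
≋⇒trim≡ {[]}    {[]}    α≋β = refl
≋⇒trim≡ {[]}    {y ∷ β} α≋β rewrite sym (≋-at α≋β 0) | sym (≋⇒trim≡ {[]} {β} (≋-tl α≋β)) = refl
≋⇒trim≡ {x ∷ α} {[]}    α≋β rewrite ≋-at α≋β 0 | ≋⇒trim≡ {α} {[]} (≋-tl α≋β) = refl
≋⇒trim≡ {x ∷ α} {y ∷ β} α≋β = cong₂ _∷′_ (≋-at α≋β 0) (≋⇒trim≡ {α} {β} (≋-tl α≋β))

Canon-≋⇒≡ : ∀ {a a′} → Canon a → Canon a′ → a ≋ a′ → a ≡ a′
Canon-≋⇒≡ {a} {a′} c c′ a≋a′ = trans (sym (trim-Canon c)) (trans (≋⇒trim≡ a≋a′) (trim-Canon c′))

Decreasing : Mon → Set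
Decreasing = Linked ℕ._≥_

Decreasing-at : ∀ {α} → Decreasing α → ∀ j → at α (suc j) ≤ at α j
Decreasing-at []            j       = z≤n
Decreasing-at [-]           j       = z≤n
Decreasing-at (x≥y ∷ _)     zero    = x≥y
Decreasing-at (_ ∷ y∷α-dec) (suc j) = Decreasing-at y∷α-dec j

Decreasing-at≤hd : ∀ {α} → Decreasing α → ∀ j → at α j ≤ hd α
Decreasing-at≤hd {α} dec zero    = ℕₚ.≤-reflexive (at-hd α)
Decreasing-at≤hd {α} dec (suc j) = ℕₚ.≤-trans (Decreasing-at dec j) (Decreasing-at≤hd dec j)

Decreasing-weight : ∀ {α} → Decreasing α → ∀ j → suc j * at α j ≤ degree α
Decreasing-weight {[]}    dec j       = ℕₚ.≤-reflexive (ℕₚ.*-zeroʳ (suc j))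
Decreasing-weight {x ∷ α} dec zero    = ℕₚ.≤-trans (ℕₚ.≤-reflexive (ℕₚ.+-identityʳ x)) (ℕₚ.m≤m+n x (degree α))
Decreasing-weight {x ∷ α} dec (suc j) =
  ℕₚ.+-mono-≤ (ℕₚ.≤-trans (Decreasing-at≤hd (Linked.tail dec) j) (head≥ dec)) (Decreasing-weight (Linked.tail dec) j)
  where
  head≥ : Decreasing (x ∷ α) → hd α ≤ x
  head≥ [-]       = z≤n
  head≥ (x≥y ∷ _) = x≥y

Decreasing-at-≥ : ∀ {α d} → Decreasing α → degree α ≤ d → ∀ j → d ≤ j → at α j ≡ 0
Decreasing-at-≥ {α} {d} dec deg≤d j d≤j with at α j in eq
... | zero  = refl
... | suc v = ⊥-elim (ℕₚ.<-irrefl refl (ℕₚ.<-≤-trans (s≤s d≤j) (begin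
  suc j             ≤⟨ ℕₚ.m≤m*n (suc j) (suc v) ⟩
  suc j * suc v     ≡⟨ cong (suc j *_) eq ⟨
  suc j * at α j    ≤⟨ Decreasing-weight dec j ⟩
  degree α          ≤⟨ deg≤d ⟩
  d                 ∎)))
  where open ℕₚ.≤-Reasoning

applyUpTo-Decreasing : ∀ (f : ℕ → ℕ) n → (∀ j → f (suc j) ≤ f j) → Decreasing (applyUpTo f n)
applyUpTo-Decreasing f zero          f↓ = []
applyUpTo-Decreasing f (suc zero)    f↓ = [-]
applyUpTo-Decreasing f (suc (suc n)) f↓ = f↓ 0 ∷ applyUpTo-Decreasing (f ∘ suc) (suc n) (f↓ ∘ suc)

module Sort≥ = Data.List.Sort (Flip.decTotalOrder ℕₚ.≤-decTotalOrder)

-- The exponents of e in decreasing order, padded or cut to exactly d entries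
-- (nothing nonzero is cut when degree e ≤ d).
normalForm : ℕ → Mon → Mon
normalForm d e = applyUpTo (at (Sort≥.sort e)) d

module _ {d e} (deg≤d : degree e ≤ d) where

  private
    sorted-deg≤d : degree (Sort≥.sort e) ≤ d
    sorted-deg≤d = subst (_≤ d) (sym (ListAction.sum-↭ (Sort≥.sort-↭ e))) deg≤d

  normalForm-≋ : normalForm d e ≋ Sort≥.sort e
  normalForm-≋ = mk≋ λ j → case j
    where
    case : ∀ j → at (normalForm d e) j ≡ at (Sort≥.sort e) j
    case j with ℕₚ.<-≤-connex j d
    ... | inj₁ j<d = at-applyUpTo _ d j j<d
    ... | inj₂ d≤j = trans (at-applyUpTo-≥ _ d j d≤j)
                           (sym (Decreasing-at-≥ (Sort≥.sort-↗ e) sorted-deg≤d j d≤j))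

  normalForm-degree : degree (normalForm d e) ≡ degree e
  normalForm-degree = trans (≋-degree normalForm-≋) (ListAction.sum-↭ (Sort≥.sort-↭ e))

  normalForm-value : ∀ f → PadInv f → PermInv f → f e ≡ f (normalForm d e)
  normalForm-value f pad perm =
    trans (perm e (Sort≥.sort e) (↭.↭-sym (Sort≥.sort-↭ e))) (sym (≋-cong f pad normalForm-≋))

normalForm-length : ∀ d e → length (normalForm d e) ≡ d
normalForm-length d e = Listₚ.length-applyUpTo _ d

normalForm-Decreasing : ∀ d e → Decreasing (normalForm d e)
normalForm-Decreasing d e = applyUpTo-Decreasing _ d (Decreasing-at (Sort≥.sort-↗ e))

fromDigits : ℕ → List ℕ → ℕ
fromDigits B []       = 0
fromDigits B (x ∷ xs) = x * B ^ length xs + fromDigits B xs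

fromDigits-< : ∀ B xs → All (_< B) xs → fromDigits B xs < B ^ length xs
fromDigits-< B []       []          = s≤s z≤n
fromDigits-< B (x ∷ xs) (x<B ∷ xs<B) = begin-strict
  x * B ^ length xs + fromDigits B xs <⟨ ℕₚ.+-monoʳ-< (x * B ^ length xs) (fromDigits-< B xs xs<B) ⟩
  x * B ^ length xs + B ^ length xs   ≡⟨ ℕₚ.+-comm (x * B ^ length xs) _ ⟩
  suc x * B ^ length xs               ≤⟨ ℕₚ.*-monoˡ-≤ (B ^ length xs) x<B ⟩
  B * B ^ length xs                   ∎
  where open ℕₚ.≤-Reasoning

fromDigits-<ₗ : ∀ B xs ys → length xs ≡ length ys → All (_< B) xs → All (_< B) ys →
                xs <ₗ ys → fromDigits B xs < fromDigits B ys
fromDigits-<ₗ B []       []       _   _            _  lt = ⊥-elim (≮ₗ[] lt)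
fromDigits-<ₗ B (x ∷ xs) (y ∷ ys) len (_ ∷ xs<B) _ (head< x<y)
  rewrite ℕₚ.suc-injective len = begin-strict
  x * B ^ length ys + fromDigits B xs <⟨ ℕₚ.+-monoʳ-< (x * B ^ length ys) (fromDigits-< B xs xs<B) ⟩
  x * B ^ length ys + B ^ length xs   ≡⟨ cong (λ n → x * B ^ length ys + B ^ n) (ℕₚ.suc-injective len) ⟩
  x * B ^ length ys + B ^ length ys   ≡⟨ ℕₚ.+-comm (x * B ^ length ys) _ ⟩
  suc x * B ^ length ys               ≤⟨ ℕₚ.*-monoˡ-≤ (B ^ length ys) x<y ⟩
  y * B ^ length ys                   ≤⟨ ℕₚ.m≤m+n _ _ ⟩
  y * B ^ length ys + fromDigits B ys ∎
  where open ℕₚ.≤-Reasoning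
fromDigits-<ₗ B (x ∷ xs) (.x ∷ ys) len (_ ∷ xs<B) (_ ∷ ys<B) (tail< refl lt)
  rewrite ℕₚ.suc-injective len =
  ℕₚ.+-monoʳ-< (x * B ^ length ys) (fromDigits-<ₗ B xs ys (ℕₚ.suc-injective len) xs<B ys<B lt)

≗-by-differences : ∀ (F G h : ℕ → ℕ) M → (∀ j → F j ≡ F (suc j) + h j) → (∀ j → G j ≡ G (suc j) + h j) →
                   (∀ j → M ≤ j → F j ≡ G j) → ∀ j → F j ≡ G j
≗-by-differences F G h M F-step G-step F≡G-eventually j = go M j (ℕₚ.m≤n+m M j)
  where
  go : ∀ k j → M ≤ j + k → F j ≡ G j
  go zero    j M≤j   = F≡G-eventually j (subst (M ≤_) (ℕₚ.+-identityʳ j) M≤j)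
  go (suc k) j M≤j+k = begin
    F j               ≡⟨ F-step j ⟩
    F (suc j) + h j   ≡⟨ cong (_+ h j) (go k (suc j) (subst (M ≤_) (ℕₚ.+-suc j k) M≤j+k)) ⟩
    G (suc j) + h j   ≡⟨ G-step j ⟨
    G j               ∎
    where open ≡-Reasoning

𝟙-<ᵇ-suc : ∀ j t → 𝟙 (j <ᵇ suc t) ≡ 𝟙 (j <ᵇ t) + 𝟙 (j ≡ᵇ t)
𝟙-<ᵇ-suc zero    zero    = refl
𝟙-<ᵇ-suc zero    (suc t) = refl
𝟙-<ᵇ-suc (suc j) zero    = refl
𝟙-<ᵇ-suc (suc j) (suc t) = 𝟙-<ᵇ-suc j t

𝟙-≡ᵇ-≢ : ∀ {x y} → x ≢ y → 𝟙 (x ≡ᵇ y) ≡ 0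
𝟙-≡ᵇ-≢ {x} {y} x≢y with x ≡ᵇ y in eq
... | true  = ⊥-elim (x≢y (≡ᵇ-true⇒≡ eq))
... | false = refl

𝟙-<ᵇ-suc-> : ∀ {j t} → t < j → 𝟙 (j <ᵇ suc t) ≡ 0
𝟙-<ᵇ-suc-> {j} {t} t<j with j <ᵇ suc t in eq
... | true  = ⊥-elim (ℕₚ.<⇒≱ t<j (ℕₚ.≤-pred (ℕₚ.<ᵇ⇒< j (suc t) (Equivalence.from T-≡ eq))))
... | false = refl

-- The e_{τ n + 1} form an algebraic basis

module ElementaryBasis (τ τ⁻¹ : ℕ → ℕ) (τ∘τ⁻¹ : ∀ j → τ (τ⁻¹ j) ≡ j) (τ⁻¹∘τ : ∀ n → τ⁻¹ (τ n) ≡ n)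
                       (c : ℕ) (τ≤ : ∀ n → τ n ≤ n + c) (≤τ : ∀ n → n ≤ τ n + c) where

  β : ℕ → Mon
  β n = ones (suc (τ n))

  -- leadingFrom β i a is the partition whose conjugate has a_m parts equal to τ (i + m) + 1;
  -- `mult i a j` counts those conjugate parts equal to j + 1.
  mult : ℕ → List ℕ → ℕ → ℕ
  mult i []      j = 0
  mult i (k ∷ a) j = k * 𝟙 (j ≡ᵇ τ i) + mult (suc i) a j

  τ-injective : ∀ {m n} → τ m ≡ τ n → m ≡ n
  τ-injective {m} {n} eq = trans (sym (τ⁻¹∘τ m)) (trans (cong τ⁻¹ eq) (τ⁻¹∘τ n))

  at-leadingFrom-∷ : ∀ i k a j → at (leadingFrom β i (k ∷ a)) j ≡ k * 𝟙 (j <ᵇ suc (τ i)) + at (leadingFrom β (suc i) a) j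
  at-leadingFrom-∷ i k a j = trans (at-⊕ (k ⊗ β i) _ j)
    (cong (_+ at (leadingFrom β (suc i) a) j) (trans (at-⊗ k (β i) j) (cong (k *_) (at-ones (suc (τ i)) j))))

  leadingFrom-step : ∀ i a j → at (leadingFrom β i a) j ≡ at (leadingFrom β i a) (suc j) + mult i a j
  leadingFrom-step i []      j = refl
  leadingFrom-step i (k ∷ a) j = begin
    at (leadingFrom β i (k ∷ a)) j
      ≡⟨ at-leadingFrom-∷ i k a j ⟩
    k * 𝟙 (j <ᵇ suc (τ i)) + at (leadingFrom β (suc i) a) j
      ≡⟨ cong₂ (λ x y → k * x + y) (𝟙-<ᵇ-suc j (τ i)) (leadingFrom-step (suc i) a j) ⟩
    k * (𝟙 (j <ᵇ τ i) + 𝟙 (j ≡ᵇ τ i)) + (at (leadingFrom β (suc i) a) (suc j) + mult (suc i) a j)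
      ≡⟨ solve 5 (λ k x y t q → k :* (x :+ y) :+ (t :+ q) := (k :* x :+ t) :+ (k :* y :+ q)) refl
               k (𝟙 (j <ᵇ τ i)) (𝟙 (j ≡ᵇ τ i)) (at (leadingFrom β (suc i) a) (suc j)) (mult (suc i) a j) ⟩
    (k * 𝟙 (j <ᵇ τ i) + at (leadingFrom β (suc i) a) (suc j)) + (k * 𝟙 (j ≡ᵇ τ i) + mult (suc i) a j)
      ≡⟨ cong (_+ (k * 𝟙 (j ≡ᵇ τ i) + mult (suc i) a j)) (at-leadingFrom-∷ i k a (suc j)) ⟨
    at (leadingFrom β i (k ∷ a)) (suc j) + mult i (k ∷ a) j ∎
    where
    open ≡-Reasoning
    open import Data.Nat.Solver using (module +-*-Solver)
    open +-*-Solver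

  mult-below : ∀ i a m → m < i → mult i a (τ m) ≡ 0
  mult-below i []      m m<i = refl
  mult-below i (k ∷ a) m m<i
    rewrite 𝟙-≡ᵇ-≢ (ℕₚ.<⇒≢ m<i ∘ τ-injective) | ℕₚ.*-zeroʳ k = mult-below (suc i) a m (ℕₚ.m<n⇒m<1+n m<i)

  mult-at : ∀ i a m → mult i a (τ (i + m)) ≡ at a m
  mult-at i []      m       = refl
  mult-at i (k ∷ a) zero
    rewrite ℕₚ.+-identityʳ i | Equivalence.to T-≡ (ℕₚ.≡⇒≡ᵇ (τ i) (τ i) refl) | ℕₚ.*-identityʳ k
          | mult-below (suc i) a i (ℕₚ.n<1+n i) = ℕₚ.+-identityʳ k
  mult-at i (k ∷ a) (suc m)
    rewrite ℕₚ.+-suc i m | 𝟙-≡ᵇ-≢ (ℕₚ.m≢1+m+n i ∘ sym ∘ τ-injective {suc (i + m)} {i}) | ℕₚ.*-zeroʳ k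
    = mult-at (suc i) a m

  leading : List ℕ → Mon
  leading = leadingFrom β 0

  mult-leading : ∀ a j → mult 0 a j ≡ at a (τ⁻¹ j)
  mult-leading a j = trans (cong (mult 0 a) (sym (τ∘τ⁻¹ j))) (mult-at 0 a (τ⁻¹ j))

  leading-injective : ∀ {a a′} → Canon a → Canon a′ → leading a ≋ leading a′ → a ≡ a′
  leading-injective {a} {a′} c c′ lead≋ = Canon-≋⇒≡ c c′ (mk≋ λ m → begin
    at a m              ≡⟨ mult-at 0 a m ⟨
    mult 0 a (τ m)      ≡⟨ mult≡ (τ m) ⟩
    mult 0 a′ (τ m)     ≡⟨ mult-at 0 a′ m ⟩
    at a′ m             ∎)
    where
    open ≡-Reasoning
    mult≡ : ∀ j → mult 0 a j ≡ mult 0 a′ j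
    mult≡ j = ℕₚ.+-cancelˡ-≡ (at (leading a) (suc j)) _ _ (begin
      at (leading a) (suc j) + mult 0 a j    ≡⟨ leadingFrom-step 0 a j ⟨
      at (leading a) j                       ≡⟨ ≋-at lead≋ j ⟩
      at (leading a′) j                      ≡⟨ leadingFrom-step 0 a′ j ⟩
      at (leading a′) (suc j) + mult 0 a′ j  ≡⟨ cong (_+ mult 0 a′ j) (≋-at lead≋ (suc j)) ⟨
      at (leading a) (suc j) + mult 0 a′ j   ∎)

  at-leadingFrom-≥ : ∀ i a j → (∀ n → n < length a → τ (i + n) < j) → at (leadingFrom β i a) j ≡ 0
  at-leadingFrom-≥ i []      j τ<j = refl
  at-leadingFrom-≥ i (k ∷ a) j τ<j
    rewrite at-leadingFrom-∷ i k a j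
          | 𝟙-<ᵇ-suc-> (subst (_< j) (cong τ (ℕₚ.+-identityʳ i)) (τ<j 0 (s≤s z≤n))) | ℕₚ.*-zeroʳ k
    = at-leadingFrom-≥ (suc i) a j (λ n n<len → subst (_< j) (cong τ (ℕₚ.+-suc i n)) (τ<j (suc n) (s≤s n<len)))

  -- For a partition ν, take a_m = ν_{τ m} − ν_{τ m + 1}, which vanishes once τ m ≥ length ν.
  leading-surjective : ∀ ν → Decreasing ν → Σ (List ℕ) λ a → Canon a × leading a ≋ ν
  leading-surjective ν dec = a , Canon-trim l , mk≋ (≗-by-differences (at (leading a)) (at ν) diff M
      (λ j → trans (leadingFrom-step 0 a j) (cong (at (leading a) (suc j) +_) (mult≡diff j)))
      (λ j → sym (ℕₚ.m+[n∸m]≡n (Decreasing-at dec j)))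
      (λ j M≤j → trans (at-leadingFrom-≥ 0 a j (λ n n<len → ℕₚ.<-≤-trans (τ<M n n<len) M≤j))
                       (sym (at-≥length ν j (ℕₚ.≤-trans D≤M M≤j)))))
    where
    D N M : ℕ
    D = length ν
    N = D + c
    M = N + c
    diff : ℕ → ℕ
    diff j = at ν j ∸ at ν (suc j)
    l a : List ℕ
    l = applyUpTo (diff ∘ τ) N
    a = trim l
    at-a : ∀ m → at a m ≡ diff (τ m)
    at-a m with ℕₚ.<-≤-connex m N
    ... | inj₁ m<N = trans (≋-at (trim-≋ l) m) (at-applyUpTo _ N m m<N)
    ... | inj₂ N≤m = trans (≋-at (trim-≋ l) m) (trans (at-applyUpTo-≥ _ N m N≤m)
                       (sym (cong₂ _∸_ (at-≥length ν (τ m) D≤τm) (at-≥length ν (suc (τ m)) (ℕₚ.m≤n⇒m≤1+n D≤τm)))))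
      where
      D≤τm : D ≤ τ m
      D≤τm = ℕₚ.+-cancelʳ-≤ c D (τ m) (ℕₚ.≤-trans N≤m (≤τ m))
    mult≡diff : ∀ j → mult 0 a j ≡ diff j
    mult≡diff j = trans (mult-leading a j) (trans (at-a (τ⁻¹ j)) (cong diff (τ∘τ⁻¹ j)))
    length-a≤N : length a ≤ N
    length-a≤N = ℕₚ.≤-trans (length-trim l) (ℕₚ.≤-reflexive (Listₚ.length-applyUpTo _ N))
    τ<M : ∀ n → n < length a → τ n < M
    τ<M n n<len = ℕₚ.≤-<-trans (τ≤ n) (ℕₚ.+-monoˡ-< c (ℕₚ.<-≤-trans n<len length-a≤N))
    D≤M : D ≤ M
    D≤M = ℕₚ.≤-trans (ℕₚ.m≤m+n D c) (ℕₚ.m≤m+n N c)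

  module _ (b : ℕ → Ser) (κ : ℕ → ℚ) (κ-pos : ∀ n → Positive (κ n))
           (b≈ : ∀ n → b n ≈ scale (κ n) (elementary (suc (τ n)))) where

    b-vanishes : ∀ n e → elementary (suc (τ n)) e ≡ 0ℚ → b n e ≡ 0ℚ
    b-vanishes n e eₙ≡0 = trans (b≈ n e) (trans (cong (κ n ℚ.*_) eₙ≡0) (ℚₚ.*-zeroʳ (κ n)))

    b-pad : ∀ n → PadInv (b n)
    b-pad n = PadInv-resp-≈ (λ e → sym (b≈ n e)) (PadInv-scale (κ n) _ (PadInv-elementary (suc (τ n))))

    b-perm : ∀ n → PermInv (b n)
    b-perm n = PermInv-resp-≈ (λ e → sym (b≈ n e)) (PermInv-scale (κ n) _ (PermInv-elementary (suc (τ n))))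

    b-homogeneous : ∀ n → Homogeneous (suc (τ n)) (b n)
    b-homogeneous n e deg≢ = b-vanishes n e (elementary-homogeneous (suc (τ n)) e deg≢)

    b-Support≤ₗ : ∀ n → Support≤ₗ (b n) (β n)
    b-Support≤ₗ n e lt = b-vanishes n e (elementary-Support≤ₗ (suc (τ n)) e lt)

    b-leading-pos : ∀ n → Positive (b n (β n))
    b-leading-pos n = subst Positive (sym (begin
      b n (β n)                                ≡⟨ b≈ n (β n) ⟩
      κ n ℚ.* elementary (suc (τ n)) (β n)     ≡⟨ cong (κ n ℚ.*_) (elementary-ones (suc (τ n))) ⟩
      κ n ℚ.* 1ℚ                               ≡⟨ ℚₚ.*-identityʳ (κ n) ⟩
      κ n                                      ∎)) (κ-pos n)
      where open ≡-Reasoning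

    open Monomials b β b-pad b-Support≤ₗ b-leading-pos

    mono-homogeneous : ∀ a → Homogeneous (weightFrom (suc ∘ τ) 0 a) (mono b a)
    mono-homogeneous = monoFrom-homogeneous b (suc ∘ τ) b-homogeneous 0

    degree-leading : ∀ a → degree (leading a) ≡ weightFrom (suc ∘ τ) 0 a
    degree-leading a = homogeneous-degree (mono-homogeneous a) (pos⇒≢0 _ {{monoFrom-leading-pos 0 a}})

    -- Among the terms with nonzero coefficient, the one whose monomial has the lexicographically
    -- largest leading exponent x* is the only one contributing to the coefficient of x*.
    independent : AlgIndep b
    independent ts canon uniq any≢0 eval≈0
      with lexMaximal (leading ∘ proj₂) (λ t → ¬? (proj₁ t ℚₚ.≟ 0ℚ)) ts any≢0
    ... | (c* , a*) , t*∈ts , c*≢0 , max =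
      c*≢0 (x*y≡0⇒x≡0 c* (mono b a* x*) {{monoFrom-leading-pos 0 a*}} (begin
        c* ℚ.* mono b a* x*                                ≡⟨ ∑-single-key proj₂ term uniq t*∈ts other≡0 ⟨
        ∑ term ts                                          ≡⟨ sumS-map (λ t → scale (proj₁ t) (mono b (proj₂ t))) ts x* ⟨
        evalPoly b ts x*                                   ≡⟨ eval≈0 x* ⟩
        0ℚ                                                 ∎))
      where
      open ≡-Reasoning
      x* : Mon
      x* = leading a*
      term : ℚ × List ℕ → ℚ
      term (c , a) = c ℚ.* mono b a x*
      canonical : ∀ {t} → t ∈ ts → Canon (proj₂ t)
      canonical t∈ts = All.lookup (Allₚ.map⁻ canon) t∈ts
      other≡0 : ∀ t → t ∈ ts → proj₂ t ≢ a* → term t ≡ 0ℚ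
      other≡0 (c , a) t∈ts a≢a* with c ℚₚ.≟ 0ℚ
      ... | yes refl = ℚₚ.*-zeroˡ (mono b a x*)
      ... | no  c≢0 with compareₗ x* (leading a)
      ...   | inj₁ x*<lead        = ⊥-elim (All.lookup max t∈ts c≢0 x*<lead)
      ...   | inj₂ (inj₁ x*≋lead) = ⊥-elim (a≢a* (leading-injective (canonical t∈ts) (canonical t*∈ts) (≋-sym x*≋lead)))
      ...   | inj₂ (inj₂ lead<x*) = trans (cong (c ℚ.*_) (monoFrom-Support≤ₗ 0 a x* lead<x*)) (ℚₚ.*-zeroʳ c)

    Polynomial : Ser → Set
    Polynomial g = ∃ λ ts → evalPoly b ts ≈ g

    DegreeBounded : ℕ → Ser → Set
    DegreeBounded d g = ∀ e → d < degree e → g e ≡ 0ℚ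

    Candidate : ℕ → Mon → Set
    Candidate d ν = length ν ≡ d × Decreasing ν × degree ν ≤ d

    candidate? : ∀ d ν → Dec (Candidate d ν)
    candidate? d ν = (length ν ℕ.≟ d) ×-dec (Linked.linked? (λ x y → y ℕ.≤? x) ν ×-dec (degree ν ℕ.≤? d))

    candidate-entries : ∀ {d ν} → Candidate d ν → All (_< suc d) ν
    candidate-entries {d} {ν} (_ , _ , deg≤d) = All.map (λ x≤deg → s≤s (ℕₚ.≤-trans x≤deg deg≤d)) (entries≤degree ν)
      where
      entries≤degree : ∀ α → All (_≤ degree α) α
      entries≤degree []      = []
      entries≤degree (x ∷ α) = ℕₚ.m≤m+n x (degree α)
                             ∷ All.map (λ y≤ → ℕₚ.≤-trans y≤ (ℕₚ.m≤n+m (degree α) x)) (entries≤degree α)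

    normalForm-Candidate : ∀ d e → degree e ≤ d → Candidate d (normalForm d e)
    normalForm-Candidate d e deg≤d =
      normalForm-length d e , normalForm-Decreasing d e , subst (_≤ d) (sym (normalForm-degree deg≤d)) deg≤d

    code : ℕ → Mon → ℕ
    code d = fromDigits (suc d)

    candidate-code : ∀ {d ν} → Candidate d ν → code d ν < suc d ^ d
    candidate-code {d} {ν} cand@(len , _) = subst (λ n → code d ν < suc d ^ n) len (fromDigits-< (suc d) ν (candidate-entries cand))

    VanishesFrom : ℕ → ℕ → Ser → Set
    VanishesFrom d N g = ∀ ν → Candidate d ν → N ≤ code d ν → g ν ≡ 0ℚ

    vanishes-everywhere : ∀ {d g} → PadInv g → PermInv g → DegreeBounded d g → VanishesFrom d 0 g → ∀ e → g e ≡ 0ℚ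
    vanishes-everywhere {d} {g} pad perm bounded vanish e with d ℕ.<? degree e
    ... | yes d<deg = bounded e d<deg
    ... | no  d≮deg = trans (normalForm-value deg≤d g pad perm) (vanish _ (normalForm-Candidate d e deg≤d) z≤n)
      where deg≤d = ℕₚ.≮⇒≥ d≮deg

    module RemoveLeadingTerm {d N g} (pad : PadInv g) (perm : PermInv g) (bounded : DegreeBounded d g)
                  (vanish : VanishesFrom d (suc N) g) {ν} (cand : Candidate d ν) (code≡N : code d ν ≡ N) where

      a : List ℕ
      a = proj₁ (leading-surjective ν (proj₁ (proj₂ cand)))

      leading≋ν : leading a ≋ ν
      leading≋ν = proj₂ (proj₂ (leading-surjective ν (proj₁ (proj₂ cand))))

      leadCoef : ℚ
      leadCoef = mono b a (leading a)

      instance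
        leadCoef≢0 : ℚ.NonZero leadCoef
        leadCoef≢0 = ℚₚ.pos⇒nonZero leadCoef {{monoFrom-leading-pos 0 a}}

      coef : ℚ
      coef = g ν ℚ.* ℚ.1/ leadCoef

      g′ : Ser
      g′ = g +S scale (ℚ.- coef) (mono b a)

      g′-pad : PadInv g′
      g′-pad = PadInv-+S g _ pad (PadInv-scale (ℚ.- coef) (mono b a) (PadInv-monoFrom b b-pad 0 a))

      g′-perm : PermInv g′
      g′-perm = PermInv-+S g _ perm (PermInv-scale (ℚ.- coef) (mono b a) (PermInv-monoFrom b b-perm 0 a))

      g′-zero : ∀ {e} → g e ≡ 0ℚ → mono b a e ≡ 0ℚ → g′ e ≡ 0ℚ
      g′-zero g≡0 m≡0 rewrite g≡0 | m≡0 = trans (ℚₚ.+-identityˡ _) (ℚₚ.*-zeroʳ (ℚ.- coef))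

      g′-bounded : DegreeBounded d g′
      g′-bounded e d<deg = g′-zero (bounded e d<deg) (mono-homogeneous a e deg≢)
        where
        deg≢ : degree e ≢ weightFrom (suc ∘ τ) 0 a
        deg≢ deg≡ = ℕₚ.<⇒≱ d<deg (begin
          degree e                    ≡⟨ deg≡ ⟩
          weightFrom (suc ∘ τ) 0 a    ≡⟨ degree-leading a ⟨
          degree (leading a)          ≡⟨ ≋-degree leading≋ν ⟩
          degree ν                    ≤⟨ proj₂ (proj₂ cand) ⟩
          d                           ∎)
          where open ℕₚ.≤-Reasoning

      g′-vanish : VanishesFrom d N g′
      g′-vanish ν′ cand′ N≤code′ with compareₗ ν ν′
      ... | inj₁ ν<ν′ = g′-zero (vanish ν′ cand′ (subst (_< code d ν′) code≡N code<code′))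
                                (monoFrom-Support≤ₗ 0 a ν′ (<ₗ-respˡ-≋ (≋-sym leading≋ν) ν<ν′))
        where
        code<code′ : code d ν < code d ν′
        code<code′ = fromDigits-<ₗ (suc d) ν ν′ (trans (proj₁ cand) (sym (proj₁ cand′)))
                       (candidate-entries cand) (candidate-entries cand′) ν<ν′
      ... | inj₂ (inj₁ ν≋ν′) rewrite sym (≋-length⇒≡ (trans (proj₁ cand) (sym (proj₁ cand′))) ν≋ν′) =
        trans (cong (λ m → g ν ℚ.+ (ℚ.- coef) ℚ.* m) mono-at-ν) (x-[x/k]*k≡0 (g ν) leadCoef)
        where
        mono-at-ν : mono b a ν ≡ leadCoef
        mono-at-ν = sym (≋-cong (mono b a) (PadInv-monoFrom b b-pad 0 a) leading≋ν)
      ... | inj₂ (inj₂ ν′<ν) = ⊥-elim (ℕₚ.<⇒≱ code′<N N≤code′)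
        where
        code′<N : code d ν′ < N
        code′<N = subst (code d ν′ <_) code≡N (fromDigits-<ₗ (suc d) ν′ ν (trans (proj₁ cand′) (sym (proj₁ cand)))
                    (candidate-entries cand′) (candidate-entries cand) ν′<ν)

      polynomial-from : Polynomial g′ → Polynomial g
      polynomial-from (ts , eval≈g′) =
        (coef , a) ∷ ts , λ e → trans (cong (coef ℚ.* mono b a e ℚ.+_) (eval≈g′ e)) (c*m+[x-c*m]≡x coef (mono b a e) (g e))

    candidate∈ : ∀ {d ν} → Candidate d ν → ν ∈ allLists d (upTo (suc d))
    candidate∈ {d} {ν} cand = ∈-allLists d (upTo (suc d)) ν (proj₁ cand) (All.map ∈ₚ.∈-upTo⁺ (candidate-entries cand))

    -- Downward induction along the lexicographic order, which on candidates (decreasing lists of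
    -- length d) is made well-founded by reading them as numerals in base d + 1.
    polynomial : ∀ d N g → PadInv g → PermInv g → DegreeBounded d g → VanishesFrom d N g → Polynomial g
    polynomial d zero    g pad perm bounded vanish = [] , λ e → sym (vanishes-everywhere pad perm bounded vanish e)
    polynomial d (suc N) g pad perm bounded vanish
      with Any.any? (λ ν → candidate? d ν ×-dec (code d ν ℕ.≟ N)) (allLists d (upTo (suc d)))
    ... | yes found = let ν , cand , code≡N = Any.satisfied found
                          open RemoveLeadingTerm pad perm bounded vanish cand code≡N
                      in polynomial-from (polynomial d N g′ g′-pad g′-perm g′-bounded g′-vanish)
    ... | no  none  = polynomial d N g pad perm bounded vanish′
      where
      vanish′ : VanishesFrom d N g
      vanish′ ν cand N≤code with code d ν ℕ.≟ N
      ... | yes code≡N = ⊥-elim (none (lose (candidate∈ cand) (cand , code≡N)))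
      ... | no  code≢N = vanish ν cand (ℕₚ.≤∧≢⇒< N≤code (code≢N ∘ sym))

    generates : Generates b
    generates f (pad , perm , d , bounded) = polynomial d (suc d ^ d) f pad perm bounded
      (λ ν cand big → ⊥-elim (ℕₚ.<⇒≱ (candidate-code cand) big))

    basis : AlgBasis b
    basis = independent , generates

swap : ℕ → ℕ → ℕ
swap k zero    = k
swap k (suc n) = if suc n ≡ᵇ k then 0 else suc n

swap-involutive : ∀ k n → swap k (swap k n) ≡ n
swap-involutive zero    zero = refl
swap-involutive (suc k) zero rewrite Equivalence.to T-≡ (ℕₚ.≡⇒≡ᵇ k k refl) = refl
swap-involutive k (suc n) with suc n ≡ᵇ k in eq
... | true  = sym (≡ᵇ-true⇒≡ eq)
... | false rewrite eq = refl

swap-≤ : ∀ k n → swap k n ≤ n + k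
swap-≤ k zero    = ℕₚ.≤-refl
swap-≤ k (suc n) with suc n ≡ᵇ k
... | true  = z≤n
... | false = ℕₚ.m≤m+n (suc n) k

≤-swap : ∀ k n → n ≤ swap k n + k
≤-swap k zero    = z≤n
≤-swap k (suc n) with suc n ≡ᵇ k in eq
... | true  = ℕₚ.≤-reflexive (≡ᵇ-true⇒≡ eq)
... | false = ℕₚ.m≤m+n (suc n) k

complete-Iso⇒≡ : ∀ m n → Iso (complete m) (complete n) → m ≡ n
complete-Iso⇒≡ m n (f , g , g∘f , f∘g , _) = ℕₚ.≤-antisym
  (Finₚ.injective⇒≤ {f = f} (λ {x} {y} fx≡fy → trans (sym (g∘f x)) (trans (cong g fx≡fy) (g∘f y))))
  (Finₚ.injective⇒≤ {f = g} (λ {x} {y} gx≡gy → trans (sym (f∘g x)) (trans (cong f gx≡gy) (f∘g y))))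

mainTheorem18 : ∃ λ (S : ℕ → ℕ → Digraph) →
    (∀ k n → Loopless (S k n))
    × (∀ k → AlgBasis (λ n → U (S k n)))
    × (∀ i j → i ≢ j → ∃ λ n → ¬ Iso (S i n) (S j n))
mainTheorem18 = S , (λ k n → complete-loopless _) , basis , distinct
  where
  S : ℕ → ℕ → Digraph
  S k n = complete (suc (swap k n))
  basis : ∀ k → AlgBasis (λ n → U (S k n))
  basis k = ElementaryBasis.basis (swap k) (swap k) (swap-involutive k) (swap-involutive k) k (swap-≤ k) (≤-swap k)
    (λ n → U (S k n)) (λ n → count (listings (suc (swap k n))))
    (λ n → count-pos (allFin∈listings (suc (swap k n)))) (λ n → U-complete (suc (swap k n)))
  distinct : ∀ i j → i ≢ j → ∃ λ n → ¬ Iso (S i n) (S j n)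
  distinct i j i≢j = 0 , i≢j ∘ ℕₚ.suc-injective ∘ complete-Iso⇒≡ (suc i) (suc j)
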